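{- For a permutation $\pi$ of $[n]$ let $G_\pi$ be its grid graph (defined in the context), and let $\mathrm{Av}_n(213)$ be the set of $213$-avoiding permutations of $[n]$. Let $H_n=\sum_{\pi\in\mathrm{Av}_n(213)}\sum_{t=1}^{n-1}\min\{\pi_t,\pi_{t+1}\}$. For $n\ge1$, \[ V_n:=\sum_{\pi\in\mathrm{Av}_n(213)}|V(G_\pi)|=|\mathrm{Av}_n(213)|\cdot\frac{n(n+1)}{2}=\frac{n}{2}\binom{2n}{n}, \] \[ \Sigma_n:=\sum_{\pi\in\mathrm{Av}_n(213)}\sum_{v\in V(G_\pi)}\deg(v)=|\mathrm{Av}_n(213)|\cdot n(n-1)+2H_n=\frac{2n^2}{n+1}\binom{2n}{n}-2\cdot4^{\,n-1}. \] In particular, for $n\ge 2$, setting $Q_r(n)=\sum_{\pi\in\mathrm{Av}_n(213)}\#\{v\in V(G_\pi):\deg(v)=r\}$ for $r\in\{1,2,3,4\}$, \[ Q_1(n)+Q_2(n)+Q_3(n)+Q_4(n)=V_n,\qquad Q_1(n)+2Q_2(n)+3Q_3(n)+4Q_4(n)=\Sigma_n. \]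
   Context: The grid graph $G_\pi$ of a permutation $\pi=\pi_1\cdots\pi_n$ of $[n]$ has vertex set $\{(i,j):1\le i\le n,\ 1\le j\le \pi_i\}$; two vertices $(i,j),(i',j')$ are adjacent iff either $i=i'$ and $|j-j'|=1$, or $|i-i'|=1$ and $j=j'$. For $n\ge2$ every vertex has degree in $\{1,2,3,4\}$. A permutation avoids $213$ if there are no indices $p<q<r$ with $\pi_q<\pi_p<\pi_r$. -}

module Defs where

open import Data.Nat using (ℕ; zero; suc; _+_; _*_; _∸_; _≡ᵇ_; _<ᵇ_; _⊓_; ∣_-_∣)
open import Data.Bool using (Bool; true; false; _∧_; _∨_; not; if_then_else_)
open import Data.Nat.ListAction using (sum)
open import Data.List using (List; []; _∷_; map; concatMap; filter; length; upTo; zipWith; drop; foldr)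
open import Data.Product using (_×_; _,_)
open import Relation.Nullary.Decidable using (yes; no; Dec)
open import Relation.Binary.PropositionalEquality using (_≡_; refl)

range1 : ℕ → List ℕ
range1 k = map suc (upTo k)

words : ℕ → ℕ → List (List ℕ)
words zero    k = [] ∷ []
words (suc m) k = concatMap (λ w → map (λ x → x ∷ w) (range1 k)) (words m k)

-- 1-indexed access: at w i = w_i  (and 0 outside 1..length w)
at : List ℕ → ℕ → ℕ
at []       i             = 0
at (x ∷ xs) zero          = 0
at (x ∷ xs) (suc zero)    = x
at (x ∷ xs) (suc (suc i)) = at xs (suc i)

anyB : {A : Set} → (A → Bool) → List A → Bool
anyB p = foldr (λ a b → p a ∨ b) false

allB : {A : Set} → (A → Bool) → List A → Bool
allB p = foldr (λ a b → p a ∧ b) true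

distinctB : List ℕ → Bool
distinctB w = allB (λ p → allB (λ q → not (p <ᵇ q) ∨ not (at w p ≡ᵇ at w q)) (range1 (length w))) (range1 (length w))

-- a word of length n over [1..n] with distinct entries is a permutation of [n]
-- avoids 213: no p < q < r with w_q < w_p < w_r
avoids213B : List ℕ → Bool
avoids213B w =
  let n = length w in
  allB (λ p → allB (λ q → allB (λ r →
    not ((p <ᵇ q) ∧ (q <ᵇ r) ∧ (at w q <ᵇ at w p) ∧ (at w p <ᵇ at w r)))
    (range1 n)) (range1 n)) (range1 n)

Perms : ℕ → List (List ℕ)
Perms n = filter (λ w → distinctB w Data.Bool.≟ true) (words n n)
  where import Data.Bool

Av213 : ℕ → List (List ℕ)
Av213 n = filter (λ w → avoids213B w Data.Bool.≟ true) (Perms n)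
  where import Data.Bool

Vertex : Set
Vertex = ℕ × ℕ

gridV : List ℕ → List Vertex
gridV π = concatMap (λ i → map (λ j → (i , j)) (range1 (at π i))) (range1 (length π))

adjB : Vertex → Vertex → Bool
adjB (i , j) (i' , j') = ((i ≡ᵇ i') ∧ (∣ j - j' ∣ ≡ᵇ 1)) ∨ ((∣ i - i' ∣ ≡ᵇ 1) ∧ (j ≡ᵇ j'))

count : {A : Set} → (A → Bool) → List A → ℕ
count p []       = 0
count p (x ∷ xs) = (if p x then 1 else 0) + count p xs

deg : List ℕ → Vertex → ℕ
deg π v = count (adjB v) (gridV π)

sumOver : List (List ℕ) → (List ℕ → ℕ) → ℕ
sumOver L f = sum (map f L)

minAdj : List ℕ → ℕ
minAdj π = sum (map (λ t → at π t ⊓ at π (suc t)) (range1 (length π ∸ 1)))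

H : ℕ → ℕ
H n = sumOver (Av213 n) minAdj

V : ℕ → ℕ
V n = sumOver (Av213 n) (λ π → length (gridV π))

Sig : ℕ → ℕ
Sig n = sumOver (Av213 n) (λ π → sum (map (deg π) (gridV π)))

Q : ℕ → ℕ → ℕ
Q r n = sumOver (Av213 n) (λ π → count (λ v → deg π v ≡ᵇ r) (gridV π))

{-# OPTIONS --safe #-}
module Submission where

-- A 213-avoiding permutation of [n + 1] whose first entry is l + 1 is l + 1,
-- followed by a 213-avoider of [k] shifted up by l + 1, followed by a 213-avoider
-- of [l], where k + l = n; conversely every such word avoids 213. So Av₍ₙ₊₁₎(213)
-- is, up to order, the list of these joins: its size obeys the Catalan recurrence,
-- and a sum of a statistic over it is a convolution. The Catalan numbers are taken
-- to be the coefficients of the powers of the Catalan series, which makes their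
-- recurrence structural, and (n + 1) Cat n = C(2n, n) follows from the ballot formula.
--
-- Every permutation of [n] has entry sum n (n + 1) / 2, which gives V n. Column i
-- of the grid graph carries πᵢ - 1 vertical edges, and min(πᵢ, πᵢ₊₁) horizontal
-- edges join columns i and i + 1, so the degree sum is 2 Σ πᵢ - 2n + 2 Σ min(πₜ, πₜ₊₁);
-- for n ≥ 2 every degree lies in 1..4, which gives the Q identities. Writing M for
-- the statistic Σ min(πₜ, πₜ₊₁), a join has M = (l + 1) k + M γ + M δ + δ₁, and the
-- resulting convolution recursion for H n is solved by induction using
-- C(2n + 2, n + 1) + 2 Cat n = 4 C(2n, n).

open import Data.Bool using (Bool; true; false; _∧_; _∨_; not; if_then_else_; T)
open import Data.Bool.Properties using () renaming (_≟_ to _≟ᵇ_)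
open import Data.Empty using (⊥; ⊥-elim)
open import Data.List using (List; []; _∷_; [_]; map; concatMap; length; _++_; upTo)
open import Data.List.Membership.Propositional using (_∈_; find)
open import Data.List.Membership.Propositional.Properties
  using (∈-map⁺; ∈-map⁻; ∈-concatMap⁺; ∈-concatMap⁻; ∈-filter⁺; ∈-filter⁻; ∈-upTo⁺; ∈-upTo⁻; ∈-++⁻; ∈-∃++)
open import Data.List.Membership.Propositional.Properties.WithK using (unique∧set⇒bag)
open import Data.List.Properties
  using (length-map; length-++; length-upTo; map-++; map-∘; map-id; map-id-local; map-cong-local; map-injective;
         upTo-∷ʳ; ∷-injective; ∷-injectiveˡ; ∷-injectiveʳ)
open import Data.List.Relation.Binary.BagAndSetEquality using (∼bag⇒↭)
open import Data.List.Relation.Binary.Disjoint.Propositional using (Disjoint)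
open import Data.List.Relation.Binary.Permutation.Propositional using (_↭_; ↭-sym)
open import Data.List.Relation.Binary.Permutation.Propositional.Properties using (∈-resp-↭) renaming (map⁺ to ↭-map⁺)
open import Data.List.Relation.Binary.Subset.Propositional using (_⊆_)
open import Data.List.Relation.Unary.All as All using (All; []; _∷_)
import Data.List.Relation.Unary.All.Properties as All
open import Data.List.Relation.Unary.AllPairs using ([]; _∷_)
open import Data.List.Relation.Unary.Any as Any using (here; there)
open import Data.List.Relation.Unary.Unique.Propositional using (Unique)
import Data.List.Relation.Unary.Unique.Propositional.Properties as Unique
open import Data.Nat
  using (ℕ; zero; suc; _+_; _*_; _∸_; _^_; _⊓_; _≤_; _<_; _≥_; z≤n; s≤s; _≡ᵇ_; _<ᵇ_; _≤ᵇ_; ∣_-_∣; _≟_; _≤?_; _<?_)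
open import Data.List.Membership.DecPropositional _≟_ using (_∈?_)
open import Data.Nat.Combinatorics using (_C_; nCk+nC[k+1]≡[n+1]C[k+1]; nC1≡n; nCk≡nC[n∸k])
open import Data.Nat.Induction using (<-rec)
open import Data.Nat.ListAction using (sum)
open import Data.Nat.ListAction.Properties using (sum-↭; sum-++)
open import Data.Nat.Properties
open import Algebra.Properties.CommutativeSemigroup +-commutativeSemigroup using () renaming (interchange to +-interchange)
open import Data.Nat.Tactic.RingSolver using (solve-∀)
open import Data.Product using (_×_; _,_; proj₁; proj₂; ∃-syntax; uncurry)
open import Data.Sum using (_⊎_; inj₁; inj₂)
open import Data.Unit using (⊤; tt)
open import Function using (_∘_; flip; _⇔_; mk⇔)
open import Relation.Binary.Definitions using (tri<; tri≈; tri>)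
open import Relation.Binary.PropositionalEquality using (_≡_; _≢_; refl; sym; trans; cong; cong₂; subst; module ≡-Reasoning)
open import Relation.Nullary using (¬_; yes; no)

open import Defs

open ≡-Reasoning

-- Convolutions and Catalan numbers

convolve : ℕ → (ℕ → ℕ → ℕ) → ℕ
convolve zero    F = F 0 0
convolve (suc n) F = F 0 (suc n) + convolve n (λ k l → F (suc k) l)

convolve-cong : ∀ n {F G : ℕ → ℕ → ℕ} → (∀ k l → k + l ≡ n → F k l ≡ G k l) →
                convolve n F ≡ convolve n G
convolve-cong zero    F≗G = F≗G 0 0 refl
convolve-cong (suc n) F≗G =
  cong₂ _+_ (F≗G 0 (suc n) refl) (convolve-cong n (λ k l k+l≡n → F≗G (suc k) l (cong suc k+l≡n)))

convolve-+ : ∀ n (F G : ℕ → ℕ → ℕ) → convolve n (λ k l → F k l + G k l) ≡ convolve n F + convolve n G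
convolve-+ zero    F G = refl
convolve-+ (suc n) F G = begin
  F 0 (suc n) + G 0 (suc n) + convolve n (λ k l → F (suc k) l + G (suc k) l)
    ≡⟨ cong (F 0 (suc n) + G 0 (suc n) +_) (convolve-+ n _ _) ⟩
  F 0 (suc n) + G 0 (suc n) + (convolve n (λ k l → F (suc k) l) + convolve n (λ k l → G (suc k) l))
    ≡⟨ +-interchange (F 0 (suc n)) _ _ _ ⟩
  F 0 (suc n) + convolve n (λ k l → F (suc k) l) + (G 0 (suc n) + convolve n (λ k l → G (suc k) l)) ∎

convolve-* : ∀ n c (F : ℕ → ℕ → ℕ) → convolve n (λ k l → c * F k l) ≡ c * convolve n F
convolve-* zero    c F = refl
convolve-* (suc n) c F =
  trans (cong (c * F 0 (suc n) +_) (convolve-* n c _)) (sym (*-distribˡ-+ c (F 0 (suc n)) _))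

convolve-zero : ∀ n → convolve n (λ _ _ → 0) ≡ 0
convolve-zero zero    = refl
convolve-zero (suc n) = convolve-zero n

convolve-suc-last : ∀ n (F : ℕ → ℕ → ℕ) → convolve (suc n) F ≡ convolve n (λ k l → F k (suc l)) + F (suc n) 0
convolve-suc-last zero    F = refl
convolve-suc-last (suc n) F = begin
  F 0 (suc (suc n)) + convolve (suc n) (λ k l → F (suc k) l)
    ≡⟨ cong (F 0 (suc (suc n)) +_) (convolve-suc-last n (λ k l → F (suc k) l)) ⟩
  F 0 (suc (suc n)) + (convolve n (λ k l → F (suc k) (suc l)) + F (suc (suc n)) 0)
    ≡⟨ sym (+-assoc (F 0 (suc (suc n))) _ _) ⟩
  F 0 (suc (suc n)) + convolve n (λ k l → F (suc k) (suc l)) + F (suc (suc n)) 0 ∎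

convolve-flip : ∀ n (F : ℕ → ℕ → ℕ) → convolve n F ≡ convolve n (flip F)
convolve-flip zero    F = refl
convolve-flip (suc n) F = begin
  F 0 (suc n) + convolve n (λ k l → F (suc k) l)
    ≡⟨ cong (F 0 (suc n) +_) (convolve-flip n (λ k l → F (suc k) l)) ⟩
  F 0 (suc n) + convolve n (λ k l → F (suc l) k)
    ≡⟨ +-comm (F 0 (suc n)) _ ⟩
  convolve n (λ k l → F (suc l) k) + F 0 (suc n)
    ≡⟨ sym (convolve-suc-last n (flip F)) ⟩
  convolve (suc n) (flip F) ∎

ifZero : ℕ → ℕ → ℕ
ifZero zero    x = x
ifZero (suc _) _ = 0

convolve-ifZero : ∀ n (c : ℕ → ℕ) → convolve n (λ k l → ifZero k (c l)) ≡ c n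
convolve-ifZero zero    c = refl
convolve-ifZero (suc n) c = trans (cong (c (suc n) +_) (convolve-zero n)) (+-identityʳ _)

summands-≤ : ∀ {n k l} → k + l ≡ n → k ≤ n × l ≤ n
summands-≤ {k = k} {l} refl = m≤m+n k l , m≤n+m l k

-- ballot n k is the coefficient of xⁿ in C(x)ᵏ, C the Catalan series; the
-- recursion is Cᵏ⁺¹ = Cᵏ + x Cᵏ⁺², i.e. C = 1 + x C² multiplied by Cᵏ.
ballot : ℕ → ℕ → ℕ
ballot zero    k       = 1
ballot (suc n) zero    = 0
ballot (suc n) (suc k) = ballot (suc n) k + ballot n (suc (suc k))

ballot-+ : ∀ n j k → ballot n (j + k) ≡ convolve n (λ i i' → ballot i j * ballot i' k)
ballot-+ zero    j       k = refl
ballot-+ (suc n) zero    k =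
  sym (trans (cong (ballot (suc n) k + 0 +_) (convolve-zero n)) (trans (+-identityʳ _) (+-identityʳ _)))
ballot-+ (suc n) (suc j) k = begin
  ballot (suc n) (j + k) + ballot n (suc (suc (j + k)))
    ≡⟨ cong₂ _+_ (ballot-+ (suc n) j k) (ballot-+ n (suc (suc j)) k) ⟩
  (ballot (suc n) k + 0 + convolve n (λ i i' → ballot (suc i) j * ballot i' k))
    + convolve n (λ i i' → ballot i (suc (suc j)) * ballot i' k)
    ≡⟨ +-assoc (ballot (suc n) k + 0) _ _ ⟩
  ballot (suc n) k + 0 + (convolve n (λ i i' → ballot (suc i) j * ballot i' k)
                          + convolve n (λ i i' → ballot i (suc (suc j)) * ballot i' k))
    ≡⟨ cong (ballot (suc n) k + 0 +_) (sym (convolve-+ n _ _)) ⟩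
  ballot (suc n) k + 0 + convolve n (λ i i' → ballot (suc i) j * ballot i' k + ballot i (suc (suc j)) * ballot i' k)
    ≡⟨ cong (ballot (suc n) k + 0 +_)
         (convolve-cong n (λ i i' _ → sym (*-distribʳ-+ (ballot i' k) (ballot (suc i) j) _))) ⟩
  ballot (suc n) k + 0 + convolve n (λ i i' → ballot (suc i) (suc j) * ballot i' k) ∎

catalan : ℕ → ℕ
catalan n = ballot n 1

catalan-suc : ∀ n → catalan (suc n) ≡ convolve n (λ k l → catalan k * catalan l)
catalan-suc n = ballot-+ n 1 1

centralBinomial : ℕ → ℕ
centralBinomial n = (2 * n) C n

pascal : ∀ n k → n C k + n C (suc k) ≡ suc n C suc k
pascal = nCk+nC[k+1]≡[n+1]C[k+1]

suc-*-C-suc : ∀ n k → suc k * (suc n C suc k) ≡ suc n * (n C k)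
suc-*-C-suc zero    zero    = refl
suc-*-C-suc zero    (suc k) = *-zeroʳ (suc (suc k))
suc-*-C-suc (suc n) zero    =
  trans (+-identityʳ _) (trans (nC1≡n (suc (suc n))) (sym (*-identityʳ (suc (suc n)))))
suc-*-C-suc (suc n) (suc k) = begin
  suc (suc k) * (suc (suc n) C suc (suc k))
    ≡⟨ cong (suc (suc k) *_) (sym (pascal (suc n) (suc k))) ⟩
  suc (suc k) * (suc n C suc k + suc n C suc (suc k))
    ≡⟨ *-distribˡ-+ (suc (suc k)) (suc n C suc k) (suc n C suc (suc k)) ⟩
  (suc n C suc k + suc k * (suc n C suc k)) + suc (suc k) * (suc n C suc (suc k))
    ≡⟨ cong₂ (λ s t → (suc n C suc k + s) + t) (suc-*-C-suc n k) (suc-*-C-suc n (suc k)) ⟩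
  (suc n C suc k + suc n * (n C k)) + suc n * (n C suc k)
    ≡⟨ +-assoc (suc n C suc k) (suc n * (n C k)) (suc n * (n C suc k)) ⟩
  suc n C suc k + (suc n * (n C k) + suc n * (n C suc k))
    ≡⟨ cong (suc n C suc k +_) (sym (*-distribˡ-+ (suc n) (n C k) (n C suc k))) ⟩
  suc n C suc k + suc n * (n C k + n C suc k)
    ≡⟨ cong (λ t → suc n C suc k + suc n * t) (pascal n k) ⟩
  suc (suc n) * (suc n C suc k) ∎

suc-*-pascal : ∀ n k → suc k * (n C suc k) + suc k * (n C k) ≡ suc n * (n C k)
suc-*-pascal n k = begin
  suc k * (n C suc k) + suc k * (n C k) ≡⟨ +-comm (suc k * (n C suc k)) (suc k * (n C k)) ⟩
  suc k * (n C k) + suc k * (n C suc k) ≡⟨ sym (*-distribˡ-+ (suc k) (n C k) (n C suc k)) ⟩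
  suc k * (n C k + n C suc k)           ≡⟨ cong (suc k *_) (pascal n k) ⟩
  suc k * (suc n C suc k)               ≡⟨ suc-*-C-suc n k ⟩
  suc n * (n C k)                       ∎

ballot-binomial : ∀ m k → ballot (suc m) (suc k) + (2 + (m + m + k)) C m ≡ (2 + (m + m + k)) C suc m
ballot-binomial zero    k =
  trans (cong (_+ 1) (ballot-1 k)) (trans (+-comm (suc k) 1) (sym (nC1≡n (suc (suc k)))))
  where
  ballot-1 : ∀ k → ballot 1 (suc k) ≡ suc k
  ballot-1 zero    = refl
  ballot-1 (suc k) = trans (cong (_+ 1) (ballot-1 k)) (+-comm (suc k) 1)
ballot-binomial (suc m) zero    =
  subst (λ N → ballot (suc m) 2 + N C suc m ≡ N C suc (suc m)) (cong (2 +_) (sym (N≡ m)))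
    (step (ballot-binomial m 1) P-symmetric)
  where
  P = 2 + (m + m + 1)
  N≡ : ∀ m → suc m + suc m + 0 ≡ suc (m + m + 1)
  N≡ = solve-∀
  P-symmetric : P C suc (suc m) ≡ P C suc m
  P-symmetric = sym (trans (nCk≡nC[n∸k] (subst (suc m ≤_) (sym P≡) (m≤n+m (suc m) (suc (suc m)))))
                          (cong (P C_) (trans (cong (_∸ suc m) P≡) (m+n∸n≡m (suc (suc m)) (suc m)))))
    where
    P≡ : P ≡ suc (suc m) + suc m
    P≡ = solve-∀' m
      where
      solve-∀' : ∀ m → 2 + (m + m + 1) ≡ suc (suc m) + suc m
      solve-∀' = solve-∀
  step : ∀ {X} → X + P C m ≡ P C suc m → P C suc (suc m) ≡ P C suc m → X + suc P C suc m ≡ suc P C suc (suc m)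
  step {X} h s = begin
    X + suc P C suc m         ≡⟨ cong (X +_) (sym (pascal P m)) ⟩
    X + (P C m + P C suc m)   ≡⟨ sym (+-assoc X (P C m) (P C suc m)) ⟩
    X + P C m + P C suc m     ≡⟨ cong₂ _+_ h (sym s) ⟩
    P C suc m + P C suc (suc m) ≡⟨ pascal P (suc m) ⟩
    suc P C suc (suc m)       ∎
ballot-binomial (suc m) (suc k) =
  subst (λ N → ballot (suc (suc m)) (suc k) + ballot (suc m) (suc (suc (suc k))) + N C suc m ≡ N C suc (suc m))
    (cong (2 +_) (sym (+-suc (suc m + suc m) k)))
    (step (ballot-binomial (suc m) k)
          (subst (λ N → ballot (suc m) (suc (suc (suc k))) + N C m ≡ N C suc m)
                 (cong (2 +_) (N≡ m k)) (ballot-binomial m (suc (suc k)))))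
  where
  N = 2 + (suc m + suc m + k)
  N≡ : ∀ m k → m + m + suc (suc k) ≡ suc m + suc m + k
  N≡ = solve-∀
  step : ∀ {X Y} → X + N C suc m ≡ N C suc (suc m) → Y + N C m ≡ N C suc m →
         (X + Y) + suc N C suc m ≡ suc N C suc (suc m)
  step {X} {Y} h₁ h₂ = begin
    (X + Y) + suc N C suc m         ≡⟨ cong ((X + Y) +_) (sym (pascal N m)) ⟩
    (X + Y) + (N C m + N C suc m)   ≡⟨ regroup X Y (N C m) (N C suc m) ⟩
    (X + N C suc m) + (Y + N C m)   ≡⟨ cong₂ _+_ h₁ h₂ ⟩
    N C suc (suc m) + N C suc m     ≡⟨ +-comm (N C suc (suc m)) (N C suc m) ⟩
    N C suc m + N C suc (suc m)     ≡⟨ pascal N (suc m) ⟩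
    suc N C suc (suc m)             ∎
    where
    regroup : ∀ x y p q → x + y + (p + q) ≡ (x + q) + (y + p)
    regroup = solve-∀

suc-*-catalan : ∀ n → suc n * catalan n ≡ centralBinomial n
suc-*-catalan zero    = refl
suc-*-catalan (suc m) = +-cancelʳ-≡ (suc (suc m) * D₀) (suc (suc m) * catalan (suc m)) D₁ goal
  where
  D = 2 * suc m
  D₀ = D C m
  D₁ = D C suc m
  catalan+D₀≡D₁ : catalan (suc m) + D₀ ≡ D₁
  catalan+D₀≡D₁ = subst (λ N → catalan (suc m) + N C m ≡ N C suc m) (D≡ m) (ballot-binomial m 0)
    where
    D≡ : ∀ m → 2 + (m + m + 0) ≡ 2 * suc m
    D≡ = solve-∀
  D₁-D₀-ratio : suc m * D₁ ≡ suc (suc m) * D₀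
  D₁-D₀-ratio = +-cancelʳ-≡ (suc m * D₀) (suc m * D₁) (suc (suc m) * D₀) (trans (suc-*-pascal D m) (split m D₀))
    where
    split : ∀ m u → suc (2 * suc m) * u ≡ suc (suc m) * u + suc m * u
    split = solve-∀
  goal : suc (suc m) * catalan (suc m) + suc (suc m) * D₀ ≡ D₁ + suc (suc m) * D₀
  goal = begin
    suc (suc m) * catalan (suc m) + suc (suc m) * D₀ ≡⟨ sym (*-distribˡ-+ (suc (suc m)) (catalan (suc m)) D₀) ⟩
    suc (suc m) * (catalan (suc m) + D₀)             ≡⟨ cong (suc (suc m) *_) catalan+D₀≡D₁ ⟩
    D₁ + suc m * D₁                                   ≡⟨ cong (D₁ +_) D₁-D₀-ratio ⟩
    D₁ + suc (suc m) * D₀                             ∎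

centralBinomial-suc : ∀ n → centralBinomial (suc n) + 2 * catalan n ≡ 4 * centralBinomial n
centralBinomial-suc n = *-cancelˡ-≡ _ _ (suc n) (begin
  suc n * (centralBinomial (suc n) + 2 * catalan n)
    ≡⟨ distrib (suc n) (centralBinomial (suc n)) (catalan n) ⟩
  suc n * centralBinomial (suc n) + 2 * (suc n * catalan n)
    ≡⟨ cong₂ (λ s t → suc n * s + 2 * t) (trans (cong (_C suc n) (2[1+n]≡ n)) (sym (pascal E n))) (suc-*-catalan n) ⟩
  suc n * (E C n + E C suc n) + 2 * b
    ≡⟨ cong (λ t → suc n * (t + E C suc n) + 2 * b) (sym middle-symmetric) ⟩
  suc n * (E C suc n + E C suc n) + 2 * b
    ≡⟨ cong (λ t → suc n * (t + t) + 2 * b) (sym (pascal D n)) ⟩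
  suc n * ((b + D C suc n) + (b + D C suc n)) + 2 * b
    ≡⟨ regroup (suc n) b (D C suc n) ⟩
  2 * (suc n * (D C suc n) + suc n * b) + 2 * b
    ≡⟨ cong (λ t → 2 * t + 2 * b) (suc-*-pascal D n) ⟩
  2 * (suc D * b) + 2 * b
    ≡⟨ collect n b ⟩
  suc n * (4 * b) ∎)
  where
  D = 2 * n
  E = suc D
  b = centralBinomial n
  2[1+n]≡ : ∀ n → 2 * suc n ≡ suc (suc (2 * n))
  2[1+n]≡ = solve-∀
  middle-symmetric : E C suc n ≡ E C n
  middle-symmetric = *-cancelˡ-≡ _ _ (suc n) (+-cancelˡ-≡ (suc n * (E C n)) _ _ (begin
    suc n * (E C n) + suc n * (E C suc n) ≡⟨ sym (*-distribˡ-+ (suc n) (E C n) (E C suc n)) ⟩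
    suc n * (E C n + E C suc n)           ≡⟨ cong (suc n *_) (pascal E n) ⟩
    suc n * (suc E C suc n)               ≡⟨ suc-*-C-suc E n ⟩
    suc E * (E C n)                       ≡⟨ double n (E C n) ⟩
    suc n * (E C n) + suc n * (E C n)     ∎))
    where
    double : ∀ n p → suc (suc (2 * n)) * p ≡ suc n * p + suc n * p
    double = solve-∀
  distrib : ∀ s x c → s * (x + 2 * c) ≡ s * x + 2 * (s * c)
  distrib = solve-∀
  regroup : ∀ s b u → s * ((b + u) + (b + u)) + 2 * b ≡ 2 * (s * u + s * b) + 2 * b
  regroup = solve-∀
  collect : ∀ n b → 2 * (suc (2 * n) * b) + 2 * b ≡ suc n * (4 * b)
  collect = solve-∀

firstEntryTotal : ℕ → ℕ
firstEntryTotal zero    = 0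
firstEntryTotal (suc n) = convolve n (λ k l → suc l * (catalan k * catalan l))

-- Pairing (k, l) with (l, k) turns the weights l + 1 and k + 1 into n + 2.
2*firstEntryTotal : ∀ n → 2 * firstEntryTotal n + ifZero n 1 ≡ suc n * catalan n
2*firstEntryTotal zero    = refl
2*firstEntryTotal (suc n) = begin
  2 * Hd + 0
    ≡⟨ double Hd ⟩
  Hd + Hd
    ≡⟨ cong (Hd +_) (convolve-flip n _) ⟩
  Hd + convolve n (λ k l → suc k * (catalan l * catalan k))
    ≡⟨ sym (convolve-+ n _ _) ⟩
  convolve n (λ k l → suc l * (catalan k * catalan l) + suc k * (catalan l * catalan k))
    ≡⟨ convolve-cong n (λ k l k+l≡n → subst (λ t → suc l * (catalan k * catalan l) + suc k * (catalan l * catalan k)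
                                                 ≡ suc (suc t) * (catalan k * catalan l))
                                            k+l≡n (pair k l (catalan k) (catalan l))) ⟩
  convolve n (λ k l → suc (suc n) * (catalan k * catalan l))
    ≡⟨ convolve-* n (suc (suc n)) _ ⟩
  suc (suc n) * convolve n (λ k l → catalan k * catalan l)
    ≡⟨ cong (suc (suc n) *_) (sym (catalan-suc n)) ⟩
  suc (suc n) * catalan (suc n) ∎
  where
  Hd = firstEntryTotal (suc n)
  double : ∀ x → 2 * x + 0 ≡ x + x
  double = solve-∀
  pair : ∀ k l x y → suc l * (x * y) + suc k * (y * x) ≡ suc (suc (k + l)) * (x * y)
  pair = solve-∀

deficit : ℕ → ℕ
deficit zero    = 0
deficit (suc k) = 4 ^ k

deficit-catalan : ∀ n → 2 * convolve n (λ k l → deficit k * catalan l) + centralBinomial n ≡ 4 ^ n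
deficit-catalan zero    = refl
deficit-catalan (suc n) = begin
  2 * Δ (suc n) + centralBinomial (suc n)            ≡⟨ cong (λ t → 2 * t + centralBinomial (suc n)) (Δ-suc n) ⟩
  2 * (4 * Δ n + catalan n) + centralBinomial (suc n) ≡⟨ regroup (Δ n) (catalan n) (centralBinomial (suc n)) ⟩
  8 * Δ n + (centralBinomial (suc n) + 2 * catalan n) ≡⟨ cong (8 * Δ n +_) (centralBinomial-suc n) ⟩
  8 * Δ n + 4 * centralBinomial n                    ≡⟨ factor (Δ n) (centralBinomial n) ⟩
  4 * (2 * Δ n + centralBinomial n)                  ≡⟨ cong (4 *_) (deficit-catalan n) ⟩
  4 * 4 ^ n                                          ∎
  where
  Δ : ℕ → ℕ
  Δ n = convolve n (λ k l → deficit k * catalan l)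
  Δ-suc : ∀ n → Δ (suc n) ≡ 4 * Δ n + catalan n
  Δ-suc n = begin
    convolve n (λ k l → 4 ^ k * catalan l)
      ≡⟨ convolve-cong n (λ k l _ → 4^k k l) ⟩
    convolve n (λ k l → 4 * (deficit k * catalan l) + ifZero k (catalan l))
      ≡⟨ convolve-+ n _ _ ⟩
    convolve n (λ k l → 4 * (deficit k * catalan l)) + convolve n (λ k l → ifZero k (catalan l))
      ≡⟨ cong₂ _+_ (convolve-* n 4 _) (convolve-ifZero n catalan) ⟩
    4 * Δ n + catalan n ∎
    where
    4^k : ∀ k l → 4 ^ k * catalan l ≡ 4 * (deficit k * catalan l) + ifZero k (catalan l)
    4^k zero    l = +-identityʳ (catalan l)
    4^k (suc k) l = trans (*-assoc 4 (4 ^ k) (catalan l)) (sym (+-identityʳ _))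
  regroup : ∀ t c b → 2 * (4 * t + c) + b ≡ 8 * t + (b + 2 * c)
  regroup = solve-∀
  factor : ∀ t b → 8 * t + 4 * b ≡ 4 * (2 * t + b)
  factor = solve-∀

firstEntryTotal-suc : ∀ n → 2 * convolve n (λ k l → catalan k * firstEntryTotal l) + catalan n ≡ firstEntryTotal (suc n)
firstEntryTotal-suc n = begin
  2 * convolve n (λ k l → c k * firstEntryTotal l) + c n
    ≡⟨ cong₂ _+_ (sym (convolve-* n 2 _)) (sym (trans (convolve-flip n _) (convolve-ifZero n c))) ⟩
  convolve n (λ k l → 2 * (c k * firstEntryTotal l)) + convolve n (λ k l → ifZero l (c k))
    ≡⟨ sym (convolve-+ n _ _) ⟩
  convolve n (λ k l → 2 * (c k * firstEntryTotal l) + ifZero l (c k))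
    ≡⟨ convolve-cong n (λ k l _ → pointwise k l) ⟩
  firstEntryTotal (suc n) ∎
  where
  c = catalan
  ifZero-* : ∀ l x → ifZero l x ≡ x * ifZero l 1
  ifZero-* zero    x = sym (*-identityʳ x)
  ifZero-* (suc l) x = sym (*-zeroʳ x)
  pointwise : ∀ k l → 2 * (c k * firstEntryTotal l) + ifZero l (c k) ≡ suc l * (c k * c l)
  pointwise k l = begin
    2 * (c k * firstEntryTotal l) + ifZero l (c k)      ≡⟨ cong (2 * (c k * firstEntryTotal l) +_) (ifZero-* l (c k)) ⟩
    2 * (c k * firstEntryTotal l) + c k * ifZero l 1    ≡⟨ factor (c k) (firstEntryTotal l) (ifZero l 1) ⟩
    c k * (2 * firstEntryTotal l + ifZero l 1)          ≡⟨ cong (c k *_) (2*firstEntryTotal l) ⟩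
    c k * (suc l * c l)                                 ≡⟨ swap (c k) (c l) (suc l) ⟩
    suc l * (c k * c l)                                 ∎
    where
    factor : ∀ x h i → 2 * (x * h) + x * i ≡ x * (2 * h + i)
    factor = solve-∀
    swap : ∀ x y s → x * (s * y) ≡ s * (x * y)
    swap = solve-∀

2*centralBinomial : ∀ n → 2 * centralBinomial n ≡ firstEntryTotal (suc n) + catalan n
2*centralBinomial n = *-cancelˡ-≡ _ _ 2 (begin
  2 * (2 * B)            ≡⟨ quadruple B ⟩
  4 * B                  ≡⟨ sym (centralBinomial-suc n) ⟩
  centralBinomial (suc n) + 2 * c n
    ≡⟨ cong (_+ 2 * c n) (sym (trans (2*firstEntryTotal (suc n)) (suc-*-catalan (suc n)))) ⟩
  2 * Hd + 0 + 2 * c n   ≡⟨ cong (_+ 2 * c n) (+-identityʳ (2 * Hd)) ⟩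
  2 * Hd + 2 * c n       ≡⟨ sym (*-distribˡ-+ 2 Hd (c n)) ⟩
  2 * (Hd + c n)         ∎)
  where
  B = centralBinomial n
  Hd = firstEntryTotal (suc n)
  c = catalan
  quadruple : ∀ x → 2 * (2 * x) ≡ 4 * x
  quadruple = solve-∀

convolve-catalan-weights : ∀ n →
  convolve n (λ k l → catalan k * catalan l * (2 * (suc l * k) + k * suc k + l * suc l)) + 2 * firstEntryTotal (suc n)
    ≡ catalan (suc n) * (suc n * suc (suc n))
convolve-catalan-weights n = begin
  convolve n w + 2 * firstEntryTotal (suc n)
    ≡⟨ trans (cong (convolve n w +_) (sym (convolve-* n 2 _))) (sym (convolve-+ n _ _)) ⟩
  convolve n (λ k l → w k l + 2 * (suc l * (c k * c l)))
    ≡⟨ convolve-cong n (λ k l k+l≡n → subst (λ t → w k l + 2 * (suc l * (c k * c l))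
                                                 ≡ (suc t * suc (suc t)) * (c k * c l))
                                            k+l≡n (square k l (c k) (c l))) ⟩
  convolve n (λ k l → (suc n * suc (suc n)) * (c k * c l))
    ≡⟨ convolve-* n (suc n * suc (suc n)) _ ⟩
  (suc n * suc (suc n)) * convolve n (λ k l → c k * c l)
    ≡⟨ trans (cong ((suc n * suc (suc n)) *_) (sym (catalan-suc n))) (*-comm _ (c (suc n))) ⟩
  c (suc n) * (suc n * suc (suc n)) ∎
  where
  c = catalan
  w : ℕ → ℕ → ℕ
  w k l = c k * c l * (2 * (suc l * k) + k * suc k + l * suc l)
  square : ∀ k l x y → x * y * (2 * (suc l * k) + k * suc k + l * suc l) + 2 * (suc l * (x * y))
                         ≡ (suc (k + l) * suc (suc (k + l))) * (x * y)
  square = solve-∀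

adjacentMinsTotal-step : ∀ n (X : ℕ → ℕ) → (∀ k → k ≤ n → 2 * X k + 2 * deficit k ≡ catalan k * (k * suc k)) →
  2 * convolve n (λ k l → suc l * k * (catalan k * catalan l) + X k * catalan l + catalan k * X l
                          + catalan k * firstEntryTotal l)
    + 2 * 4 ^ n ≡ catalan (suc n) * (suc n * suc (suc n))
adjacentMinsTotal-step n X IH = begin
  2 * R + 2 * 4 ^ n                ≡⟨ cong (λ t → 2 * R + 2 * t) (sym (deficit-catalan n)) ⟩
  2 * R + 2 * (2 * Δ + B)          ≡⟨ regroup (2 * R) Δ B ⟩
  (2 * R + 2 * Δ + 2 * Δ) + 2 * B  ≡⟨ cong₂ _+_ apply-IH (2*centralBinomial n) ⟩
  (W + 2 * Y) + (Hd + c n)         ≡⟨ regroup₂ W (2 * Y) Hd (c n) ⟩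
  W + Hd + (2 * Y + c n)           ≡⟨ cong (W + Hd +_) (firstEntryTotal-suc n) ⟩
  W + Hd + Hd                      ≡⟨ +-assoc W Hd Hd ⟩
  W + (Hd + Hd)                    ≡⟨ cong (W +_) (sym (double Hd)) ⟩
  W + 2 * Hd                       ≡⟨ convolve-catalan-weights n ⟩
  c (suc n) * (suc n * suc (suc n)) ∎
  where
  c = catalan
  B = centralBinomial n
  Hd = firstEntryTotal (suc n)
  r : ℕ → ℕ → ℕ
  r k l = suc l * k * (c k * c l) + X k * c l + c k * X l + c k * firstEntryTotal l
  R = convolve n r
  Δ = convolve n (λ k l → deficit k * c l)
  Y = convolve n (λ k l → c k * firstEntryTotal l)
  w : ℕ → ℕ → ℕ
  w k l = c k * c l * (2 * (suc l * k) + k * suc k + l * suc l)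
  W = convolve n w
  double : ∀ x → 2 * x ≡ x + x
  double = solve-∀
  regroup : ∀ r t b → r + 2 * (2 * t + b) ≡ (r + 2 * t + 2 * t) + 2 * b
  regroup = solve-∀
  regroup₂ : ∀ w y h c → (w + y) + (h + c) ≡ w + h + (y + c)
  regroup₂ = solve-∀

  apply-IH : 2 * R + 2 * Δ + 2 * Δ ≡ W + 2 * Y
  apply-IH = begin
    2 * R + 2 * Δ + 2 * Δ
      ≡⟨ cong₂ (λ s t → s + 2 * Δ + t) (sym (convolve-* n 2 r))
               (trans (sym (convolve-* n 2 _)) (convolve-flip n _)) ⟩
    convolve n (λ k l → 2 * r k l) + 2 * Δ + convolve n (λ k l → 2 * (deficit l * c k))
      ≡⟨ cong (λ t → convolve n (λ k l → 2 * r k l) + t + convolve n (λ k l → 2 * (deficit l * c k)))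
              (sym (convolve-* n 2 _)) ⟩
    convolve n (λ k l → 2 * r k l) + convolve n (λ k l → 2 * (deficit k * c l))
      + convolve n (λ k l → 2 * (deficit l * c k))
      ≡⟨ trans (cong (_+ convolve n (λ k l → 2 * (deficit l * c k))) (sym (convolve-+ n _ _)))
               (sym (convolve-+ n _ _)) ⟩
    convolve n (λ k l → 2 * r k l + 2 * (deficit k * c l) + 2 * (deficit l * c k))
      ≡⟨ convolve-cong n pointwise ⟩
    convolve n (λ k l → w k l + 2 * (c k * firstEntryTotal l))
      ≡⟨ trans (convolve-+ n _ _) (cong (W +_) (convolve-* n 2 _)) ⟩
    W + 2 * Y ∎
    where
    expand : ∀ A xk xl ck cl ek el H →
      2 * (A + xk * cl + ck * xl + ck * H) + 2 * (ek * cl) + 2 * (el * ck)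
        ≡ 2 * A + (2 * xk + 2 * ek) * cl + ck * (2 * xl + 2 * el) + 2 * (ck * H)
    expand = solve-∀
    collect : ∀ k l ck cl H →
      2 * (suc l * k * (ck * cl)) + ck * (k * suc k) * cl + ck * (cl * (l * suc l)) + 2 * (ck * H)
        ≡ ck * cl * (2 * (suc l * k) + k * suc k + l * suc l) + 2 * (ck * H)
    collect = solve-∀
    pointwise : ∀ k l → k + l ≡ n →
      2 * r k l + 2 * (deficit k * c l) + 2 * (deficit l * c k) ≡ w k l + 2 * (c k * firstEntryTotal l)
    pointwise k l k+l≡n = begin
      2 * r k l + 2 * (deficit k * c l) + 2 * (deficit l * c k)
        ≡⟨ expand (suc l * k * (c k * c l)) (X k) (X l) (c k) (c l) (deficit k) (deficit l) (firstEntryTotal l) ⟩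
      2 * (suc l * k * (c k * c l)) + (2 * X k + 2 * deficit k) * c l + c k * (2 * X l + 2 * deficit l)
        + 2 * (c k * firstEntryTotal l)
        ≡⟨ cong₂ (λ s t → 2 * (suc l * k * (c k * c l)) + s * c l + c k * t + 2 * (c k * firstEntryTotal l))
                 (IH k (proj₁ (summands-≤ k+l≡n))) (IH l (proj₂ (summands-≤ k+l≡n))) ⟩
      2 * (suc l * k * (c k * c l)) + c k * (k * suc k) * c l + c k * (c l * (l * suc l))
        + 2 * (c k * firstEntryTotal l)
        ≡⟨ collect k l (c k) (c l) (firstEntryTotal l) ⟩
      w k l + 2 * (c k * firstEntryTotal l) ∎

-- Sums over lists

sumMap : {A : Set} → List A → (A → ℕ) → ℕ
sumMap xs f = sum (map f xs)

sumMap-cong : {A : Set} (xs : List A) {f g : A → ℕ} → (∀ x → x ∈ xs → f x ≡ g x) → sumMap xs f ≡ sumMap xs g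
sumMap-cong xs f≗g = cong sum (map-cong-local (All.tabulate (f≗g _)))

sumMap-+ : {A : Set} (xs : List A) (f g : A → ℕ) → sumMap xs (λ x → f x + g x) ≡ sumMap xs f + sumMap xs g
sumMap-+ []       f g = refl
sumMap-+ (x ∷ xs) f g = trans (cong (f x + g x +_) (sumMap-+ xs f g)) (+-interchange (f x) (g x) _ _)

sumMap-* : {A : Set} (xs : List A) (c : ℕ) (f : A → ℕ) → sumMap xs (λ x → c * f x) ≡ c * sumMap xs f
sumMap-* []       c f = sym (*-zeroʳ c)
sumMap-* (x ∷ xs) c f = trans (cong (c * f x +_) (sumMap-* xs c f)) (sym (*-distribˡ-+ c (f x) _))

sumMap-const : {A : Set} (xs : List A) (c : ℕ) → sumMap xs (λ _ → c) ≡ length xs * c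
sumMap-const []       c = refl
sumMap-const (x ∷ xs) c = cong (c +_) (sumMap-const xs c)

length≡sumMap-1 : {A : Set} (xs : List A) → length xs ≡ sumMap xs (λ _ → 1)
length≡sumMap-1 xs = sym (trans (sumMap-const xs 1) (*-identityʳ (length xs)))

sumMap-map : {A B : Set} (h : A → B) (xs : List A) (g : B → ℕ) → sumMap (map h xs) g ≡ sumMap xs (λ x → g (h x))
sumMap-map h xs g = cong sum (sym (map-∘ xs))

sumMap-concatMap : {A B : Set} (h : A → List B) (xs : List A) (g : B → ℕ) →
                   sumMap (concatMap h xs) g ≡ sumMap xs (λ x → sumMap (h x) g)
sumMap-concatMap h []       g = refl
sumMap-concatMap h (x ∷ xs) g = begin
  sum (map g (h x ++ concatMap h xs))           ≡⟨ cong sum (map-++ g (h x) (concatMap h xs)) ⟩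
  sum (map g (h x) ++ map g (concatMap h xs))   ≡⟨ sum-++ (map g (h x)) _ ⟩
  sumMap (h x) g + sumMap (concatMap h xs) g    ≡⟨ cong (sumMap (h x) g +_) (sumMap-concatMap h xs g) ⟩
  sumMap (h x) g + sumMap xs (λ x → sumMap (h x) g) ∎

sumMap-↭ : {A : Set} {xs ys : List A} (f : A → ℕ) → xs ↭ ys → sumMap xs f ≡ sumMap ys f
sumMap-↭ f xs↭ys = sum-↭ (↭-map⁺ f xs↭ys)

concatMap-unique : {A B : Set} (g : A → List B) {xs : List A} → Unique xs → (∀ {x} → x ∈ xs → Unique (g x)) →
                   (∀ {x y} → x ∈ xs → y ∈ xs → x ≢ y → Disjoint (g x) (g y)) → Unique (concatMap g xs)
concatMap-unique g {[]}     _            _        _        = []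
concatMap-unique g {x ∷ xs} (x∉xs ∷ !xs) !g disjoint =
  Unique.++⁺ (!g (here refl))
             (concatMap-unique g !xs (λ y∈ → !g (there y∈)) (λ x∈ y∈ → disjoint (there x∈) (there y∈)))
             λ (z∈gx , z∈rest) → let (y , y∈xs , z∈gy) = find (∈-concatMap⁻ g z∈rest) in
               disjoint (here refl) (there y∈xs) (All.lookup x∉xs y∈xs) (z∈gx , z∈gy)

Unique-++⁻ : {A : Set} (xs : List A) {ys : List A} → Unique (xs ++ ys) → Unique xs × Unique ys
Unique-++⁻ []       !ys          = [] , !ys
Unique-++⁻ (x ∷ xs) (x∉ ∷ !rest) = (All.++⁻ˡ xs x∉ ∷ proj₁ (Unique-++⁻ xs !rest)) , proj₂ (Unique-++⁻ xs !rest)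

private
  ∈-++-∷⁻ : {A : Set} (as : List A) {x z : A} {bs : List A} → z ∈ as ++ x ∷ bs → z ≢ x → z ∈ as ++ bs
  ∈-++-∷⁻ []       (here refl) z≢x = ⊥-elim (z≢x refl)
  ∈-++-∷⁻ []       (there z∈)  z≢x = z∈
  ∈-++-∷⁻ (a ∷ as) (here refl) z≢x = here refl
  ∈-++-∷⁻ (a ∷ as) (there z∈)  z≢x = there (∈-++-∷⁻ as z∈ z≢x)

  length-++-∷ : {A : Set} (as : List A) {x : A} {bs : List A} → length (as ++ x ∷ bs) ≡ suc (length (as ++ bs))
  length-++-∷ []       = refl
  length-++-∷ (a ∷ as) = cong suc (length-++-∷ as)

Unique⇒length≤ : {A : Set} {xs ys : List A} → Unique xs → xs ⊆ ys → length xs ≤ length ys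
Unique⇒length≤ {xs = []}     _            _     = z≤n
Unique⇒length≤ {xs = x ∷ xs} (x∉xs ∷ !xs) xs⊆ys with ∈-∃++ (xs⊆ys (here refl))
... | as , bs , refl =
  subst (suc (length xs) ≤_) (sym (length-++-∷ as))
        (s≤s (Unique⇒length≤ !xs (λ z∈ → ∈-++-∷⁻ as (xs⊆ys (there z∈)) (λ z≡x → All.lookup x∉xs z∈ (sym z≡x)))))

Unique⇒⊇ : {xs ys : List ℕ} → Unique xs → xs ⊆ ys → length ys ≤ length xs → ys ⊆ xs
Unique⇒⊇ {xs} {ys} !xs xs⊆ys ys≤xs {z} z∈ys with z ∈? xs
... | yes z∈xs = z∈xs
... | no  z∉xs = ⊥-elim (<⇒≱ (Unique⇒length≤ {xs = z ∷ xs} !z∷xs z∷xs⊆ys) ys≤xs)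
  where
  !z∷xs : Unique (z ∷ xs)
  !z∷xs = All.tabulate (λ w∈ z≡w → z∉xs (subst (_∈ xs) (sym z≡w) w∈)) ∷ !xs
  z∷xs⊆ys : z ∷ xs ⊆ ys
  z∷xs⊆ys (here refl) = z∈ys
  z∷xs⊆ys (there w∈)  = xs⊆ys w∈

unique-↭ : {A : Set} {xs ys : List A} → Unique xs → Unique ys → (∀ {x} → x ∈ xs ⇔ x ∈ ys) → xs ↭ ys
unique-↭ !xs !ys xs⇔ys = ∼bag⇒↭ (unique∧set⇒bag !xs !ys xs⇔ys)

splits : ℕ → List (ℕ × ℕ)
splits zero    = (0 , 0) ∷ []
splits (suc n) = (0 , suc n) ∷ map (λ (k , l) → (suc k , l)) (splits n)

sumMap-splits : ∀ n (F : ℕ → ℕ → ℕ) → sumMap (splits n) (uncurry F) ≡ convolve n F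
sumMap-splits zero    F = +-identityʳ _
sumMap-splits (suc n) F =
  cong (F 0 (suc n) +_) (trans (sumMap-map _ (splits n) _) (sumMap-splits n (λ k l → F (suc k) l)))

∈-splits⁻ : ∀ n {k l} → (k , l) ∈ splits n → k + l ≡ n
∈-splits⁻ zero    (here refl) = refl
∈-splits⁻ (suc n) (here refl) = refl
∈-splits⁻ (suc n) (there kl∈) with ∈-map⁻ _ kl∈
... | _ , kl∈′ , refl = cong suc (∈-splits⁻ n kl∈′)

∈-splits⁺ : ∀ n {k l} → k + l ≡ n → (k , l) ∈ splits n
∈-splits⁺ zero    {zero}  refl = here refl
∈-splits⁺ (suc n) {zero}  refl = here refl
∈-splits⁺ (suc n) {suc k} k+l≡n = there (∈-map⁺ (λ (k , l) → (suc k , l)) (∈-splits⁺ n (suc-injective k+l≡n)))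

splits-unique : ∀ n → Unique (splits n)
splits-unique zero    = [] ∷ []
splits-unique (suc n) = All.tabulate 0≢ ∷ Unique.map⁺ suc-injectiveˡ (splits-unique n)
  where
  0≢ : ∀ {q} → q ∈ map (λ (k , l) → (suc k , l)) (splits n) → (0 , suc n) ≢ q
  0≢ q∈ with ∈-map⁻ _ q∈
  ... | _ , _ , refl = λ ()
  suc-injectiveˡ : ∀ {p q : ℕ × ℕ} → (suc (proj₁ p) , proj₂ p) ≡ (suc (proj₁ q) , proj₂ q) → p ≡ q
  suc-injectiveˡ {_ , _} {_ , _} refl = refl

sumTo : ℕ → (ℕ → ℕ) → ℕ
sumTo zero    f = 0
sumTo (suc n) f = sumTo n f + f (suc n)

sumTo-cong : ∀ n {f g : ℕ → ℕ} → (∀ i → 1 ≤ i → i ≤ n → f i ≡ g i) → sumTo n f ≡ sumTo n g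
sumTo-cong zero    f≗g = refl
sumTo-cong (suc n) f≗g =
  cong₂ _+_ (sumTo-cong n (λ i 1≤i i≤n → f≗g i 1≤i (m≤n⇒m≤1+n i≤n))) (f≗g (suc n) (s≤s z≤n) ≤-refl)

sumTo-+ : ∀ n (f g : ℕ → ℕ) → sumTo n (λ i → f i + g i) ≡ sumTo n f + sumTo n g
sumTo-+ zero    f g = refl
sumTo-+ (suc n) f g = trans (cong (_+ (f (suc n) + g (suc n))) (sumTo-+ n f g)) (+-interchange (sumTo n f) (sumTo n g) _ _)

sumTo-* : ∀ n c (f : ℕ → ℕ) → sumTo n (λ i → c * f i) ≡ c * sumTo n f
sumTo-* zero    c f = sym (*-zeroʳ c)
sumTo-* (suc n) c f = trans (cong (_+ c * f (suc n)) (sumTo-* n c f)) (sym (*-distribˡ-+ c (sumTo n f) _))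

sumTo-const : ∀ n c → sumTo n (λ _ → c) ≡ n * c
sumTo-const zero    c = refl
sumTo-const (suc n) c = trans (cong (_+ c) (sumTo-const n c)) (+-comm (n * c) c)

sumTo-zero : ∀ n {f : ℕ → ℕ} → (∀ i → 1 ≤ i → i ≤ n → f i ≡ 0) → sumTo n f ≡ 0
sumTo-zero n f≗0 = trans (sumTo-cong n f≗0) (trans (sumTo-const n 0) (*-zeroʳ n))

sumTo-suc : ∀ n (f : ℕ → ℕ) → sumTo (suc n) f ≡ f 1 + sumTo n (λ i → f (suc i))
sumTo-suc zero    f = +-comm 0 (f 1)
sumTo-suc (suc n) f = trans (cong (_+ f (suc (suc n))) (sumTo-suc n f)) (+-assoc (f 1) _ _)

2*sumTo-id : ∀ n → 2 * sumTo n (λ i → i) ≡ n * suc n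
2*sumTo-id zero    = refl
2*sumTo-id (suc n) = trans (*-distribˡ-+ 2 (sumTo n (λ i → i)) (suc n)) (trans (cong (_+ 2 * suc n) (2*sumTo-id n)) (gauss n))
  where
  gauss : ∀ n → n * suc n + 2 * suc n ≡ suc n * suc (suc n)
  gauss = solve-∀

sumMap-range1 : ∀ n (f : ℕ → ℕ) → sumMap (range1 n) f ≡ sumTo n f
sumMap-range1 zero    f = refl
sumMap-range1 (suc n) f = begin
  sum (map f (map suc (upTo (suc n))))       ≡⟨ cong (λ is → sum (map f (map suc is))) (sym (upTo-∷ʳ n)) ⟩
  sum (map f (map suc (upTo n ++ [ n ])))    ≡⟨ cong (λ is → sum (map f is)) (map-++ suc (upTo n) [ n ]) ⟩
  sum (map f (range1 n ++ [ suc n ]))        ≡⟨ cong sum (map-++ f (range1 n) [ suc n ]) ⟩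
  sum (map f (range1 n) ++ [ f (suc n) ])    ≡⟨ sum-++ (map f (range1 n)) [ f (suc n) ] ⟩
  sumMap (range1 n) f + (f (suc n) + 0)      ≡⟨ cong₂ _+_ (sumMap-range1 n f) (+-identityʳ (f (suc n))) ⟩
  sumTo n f + f (suc n)                      ∎

sumTo-at : ∀ xs (h : ℕ → ℕ) → sumTo (length xs) (λ i → h (at xs i)) ≡ sumMap xs h
sumTo-at []       h = refl
sumTo-at (x ∷ xs) h = trans (sumTo-suc (length xs) (λ i → h (at (x ∷ xs) i)))
  (cong (h x +_) (trans (sumTo-cong (length xs) (λ { (suc i) _ _ → refl })) (sumTo-at xs h)))

sumTo-at-id : ∀ xs → sumTo (length xs) (at xs) ≡ sum xs
sumTo-at-id xs = trans (sumTo-at xs (λ x → x)) (cong sum (map-id xs))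

sumMap²-+ : {A B : Set} (xs : List A) (ys : List B) (f : A → ℕ) (g : B → ℕ) →
            sumMap xs (λ x → sumMap ys (λ y → f x + g y)) ≡ length ys * sumMap xs f + length xs * sumMap ys g
sumMap²-+ xs ys f g = begin
  sumMap xs (λ x → sumMap ys (λ y → f x + g y))
    ≡⟨ sumMap-cong xs (λ x _ → trans (sumMap-+ ys (λ _ → f x) g) (cong (_+ sumMap ys g) (sumMap-const ys (f x)))) ⟩
  sumMap xs (λ x → length ys * f x + sumMap ys g)
    ≡⟨ sumMap-+ xs _ _ ⟩
  sumMap xs (λ x → length ys * f x) + sumMap xs (λ _ → sumMap ys g)
    ≡⟨ cong₂ _+_ (sumMap-* xs (length ys) f) (sumMap-const xs _) ⟩
  length ys * sumMap xs f + length xs * sumMap ys g ∎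

sumMap-+₄ : {A : Set} (xs : List A) (f g h k : A → ℕ) →
            sumMap xs (λ x → f x + g x + h x + k x) ≡ sumMap xs f + sumMap xs g + sumMap xs h + sumMap xs k
sumMap-+₄ xs f g h k = begin
  sumMap xs (λ x → f x + g x + h x + k x)
    ≡⟨ sumMap-+ xs _ k ⟩
  sumMap xs (λ x → f x + g x + h x) + sumMap xs k
    ≡⟨ cong (_+ sumMap xs k) (trans (sumMap-+ xs _ h) (cong (_+ sumMap xs h) (sumMap-+ xs f g))) ⟩
  sumMap xs f + sumMap xs g + sumMap xs h + sumMap xs k ∎

-- Permutations and 213-avoidance

InRange : ℕ → ℕ → Set
InRange n x = 0 < x × x ≤ n

∈-range1⁺ : ∀ {n z} → InRange n z → z ∈ range1 n
∈-range1⁺ {z = suc z} (_ , z<n) = ∈-map⁺ suc (∈-upTo⁺ z<n)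

∈-range1⁻ : ∀ {n z} → z ∈ range1 n → InRange n z
∈-range1⁻ z∈ with ∈-map⁻ suc z∈
... | _ , i∈ , refl = s≤s z≤n , ∈-upTo⁻ i∈

range1-unique : ∀ n → Unique (range1 n)
range1-unique n = Unique.map⁺ suc-injective (Unique.upTo⁺ n)

length-range1 : ∀ n → length (range1 n) ≡ n
length-range1 n = trans (length-map suc (upTo n)) (length-upTo n)

IsPermutation : ℕ → List ℕ → Set
IsPermutation n π = length π ≡ n × All (InRange n) π × Unique π

permutation-↭ : ∀ {n π} → IsPermutation n π → π ↭ range1 n
permutation-↭ {n} {π} (|π|≡n , π⊆ , !π) =
  unique-↭ !π (range1-unique n) (mk⇔ π⊆range1 (Unique⇒⊇ !π π⊆range1 |range1|≤|π|))
  where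
  π⊆range1 : π ⊆ range1 n
  π⊆range1 z∈ = ∈-range1⁺ (All.lookup π⊆ z∈)
  |range1|≤|π| : length (range1 n) ≤ length π
  |range1|≤|π| = ≤-reflexive (trans (length-range1 n) (sym |π|≡n))

2*sum-permutation : ∀ {n π} → IsPermutation n π → 2 * sum π ≡ n * suc n
2*sum-permutation {n} {π} perm = begin
  2 * sum π                       ≡⟨ cong (2 *_) (trans (cong sum (sym (map-id π))) (sumMap-↭ (λ i → i) (permutation-↭ perm))) ⟩
  2 * sumMap (range1 n) (λ i → i) ≡⟨ cong (2 *_) (sumMap-range1 n (λ i → i)) ⟩
  2 * sumTo n (λ i → i)           ≡⟨ 2*sumTo-id n ⟩
  n * suc n                       ∎

-- x ∷ ys contains no 213 in which x plays the role of the 2.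
No213From : ℕ → List ℕ → Set
No213From x []       = ⊤
No213From x (y ∷ ys) = (y < x → All (_≤ x) ys) × No213From x ys

Avoids213 : List ℕ → Set
Avoids213 []       = ⊤
Avoids213 (x ∷ xs) = No213From x xs × Avoids213 xs

No213From-≤ : ∀ {x ys} → All (_≤ x) ys → No213From x ys
No213From-≤ []           = tt
No213From-≤ (_ ∷ ys≤x)   = (λ _ → ys≤x) , No213From-≤ ys≤x

No213From-> : ∀ {x ys} → All (x <_) ys → No213From x ys
No213From-> []               = tt
No213From-> (x<y ∷ x<ys)     = (λ y<x → ⊥-elim (<-asym x<y y<x)) , No213From-> x<ys

No213From-++⁺ : ∀ {x} xs {ys} → No213From x xs → All (_≤ x) ys → No213From x (xs ++ ys)
No213From-++⁺ []       _          ys≤x = No213From-≤ ys≤x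
No213From-++⁺ (y ∷ xs) (h , nxs) ys≤x = (λ y<x → All.++⁺ (h y<x) ys≤x) , No213From-++⁺ xs nxs ys≤x

No213From-++⁻ˡ : ∀ {x} xs {ys} → No213From x (xs ++ ys) → No213From x xs
No213From-++⁻ˡ []       _         = tt
No213From-++⁻ˡ (y ∷ xs) (h , nxs) = (λ y<x → All.++⁻ˡ xs (h y<x)) , No213From-++⁻ˡ xs nxs

No213From-shift⁺ : ∀ c {x} ys → No213From x ys → No213From (c + x) (map (c +_) ys)
No213From-shift⁺ c []       _         = tt
No213From-shift⁺ c (y ∷ ys) (h , nys) =
  (λ c+y<c+x → All.map⁺ (All.map (+-monoʳ-≤ c) (h (+-cancelˡ-< c _ _ c+y<c+x)))) , No213From-shift⁺ c ys nys

No213From-shift⁻ : ∀ c {x} ys → No213From (c + x) (map (c +_) ys) → No213From x ys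
No213From-shift⁻ c []       _         = tt
No213From-shift⁻ c (y ∷ ys) (h , nys) =
  (λ y<x → All.map (+-cancelˡ-≤ c _ _) (All.map⁻ (h (+-monoʳ-< c y<x)))) , No213From-shift⁻ c ys nys

Avoids213-++⁺ : ∀ xs {ys} → Avoids213 xs → Avoids213 ys → All (λ x → All (_≤ x) ys) xs → Avoids213 (xs ++ ys)
Avoids213-++⁺ []       _          ays _               = ays
Avoids213-++⁺ (x ∷ xs) (nx , axs) ays (ys≤x ∷ ys≤xs) = No213From-++⁺ xs nx ys≤x , Avoids213-++⁺ xs axs ays ys≤xs

Avoids213-++⁻ˡ : ∀ xs {ys} → Avoids213 (xs ++ ys) → Avoids213 xs
Avoids213-++⁻ˡ []       _         = tt
Avoids213-++⁻ˡ (x ∷ xs) (nx , av) = No213From-++⁻ˡ xs nx , Avoids213-++⁻ˡ xs av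

Avoids213-++⁻ʳ : ∀ xs {ys} → Avoids213 (xs ++ ys) → Avoids213 ys
Avoids213-++⁻ʳ []       av       = av
Avoids213-++⁻ʳ (x ∷ xs) (_ , av) = Avoids213-++⁻ʳ xs av

Avoids213-shift⁺ : ∀ c xs → Avoids213 xs → Avoids213 (map (c +_) xs)
Avoids213-shift⁺ c []       _          = tt
Avoids213-shift⁺ c (x ∷ xs) (nx , axs) = No213From-shift⁺ c xs nx , Avoids213-shift⁺ c xs axs

Avoids213-shift⁻ : ∀ c xs → Avoids213 (map (c +_) xs) → Avoids213 xs
Avoids213-shift⁻ c []       _          = tt
Avoids213-shift⁻ c (x ∷ xs) (nx , axs) = No213From-shift⁻ c xs nx , Avoids213-shift⁻ c xs axs

IsAv213 : ℕ → List ℕ → Set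
IsAv213 n π = IsPermutation n π × Avoids213 π

join : ℕ → List ℕ → List ℕ → List ℕ
join l γ δ = suc l ∷ (map (suc l +_) γ ++ δ)

join-permutation : ∀ {k l γ δ} → IsPermutation k γ → IsPermutation l δ → IsPermutation (suc (k + l)) (join l γ δ)
join-permutation {k} {l} {γ} {δ} (|γ|≡k , γ⊆ , !γ) (|δ|≡l , δ⊆ , !δ) =
  cong suc (trans (length-++ γ′) (cong₂ _+_ (trans (length-map _ γ) |γ|≡k) |δ|≡l)) ,
  (s≤s z≤n , s≤s (m≤n+m l k)) ∷ All.++⁺ (All.map⁺ (All.map γ′-range γ⊆)) (All.map δ-range δ⊆) ,
  All.++⁺ (All.map <⇒≢ γ′>) (All.map >⇒≢ δ<) ∷
  Unique.++⁺ (Unique.map⁺ (+-cancelˡ-≡ (suc l) _ _) !γ) !δ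
             (λ (x∈γ′ , x∈δ) → <-asym (All.lookup γ′> x∈γ′) (All.lookup δ< x∈δ))
  where
  γ′ = map (suc l +_) γ
  γ′> : All (suc l <_) γ′
  γ′> = All.map⁺ (All.map (λ (0<x , _) → m<m+n (suc l) 0<x) γ⊆)
  δ< : All (_< suc l) δ
  δ< = All.map (λ (_ , x≤l) → s≤s x≤l) δ⊆
  γ′-range : ∀ {x} → InRange k x → InRange (suc (k + l)) (suc l + x)
  γ′-range {x} (_ , x≤k) = s≤s z≤n , subst (suc l + x ≤_) (cong suc (+-comm l k)) (+-monoʳ-≤ (suc l) x≤k)
  δ-range : ∀ {x} → InRange l x → InRange (suc (k + l)) x
  δ-range (0<x , x≤l) = 0<x , m≤n⇒m≤1+n (≤-trans x≤l (m≤n+m l k))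

join-avoids : ∀ {l γ δ} → All (0 <_) γ → All (_≤ l) δ → Avoids213 γ → Avoids213 δ → Avoids213 (join l γ δ)
join-avoids {l} {γ} {δ} γ>0 δ≤l aγ aδ =
  No213From-++⁺ γ′ (No213From-> γ′>) (All.map m≤n⇒m≤1+n δ≤l) ,
  Avoids213-++⁺ γ′ (Avoids213-shift⁺ (suc l) γ aγ) aδ
                (All.map (λ l<x → All.map (λ y≤l → ≤-trans y≤l (≤-trans (n≤1+n l) (<⇒≤ l<x))) δ≤l) γ′>)
  where
  γ′ = map (suc l +_) γ
  γ′> : All (suc l <_) γ′
  γ′> = All.map⁺ (All.map (m<m+n (suc l)) γ>0)

++-injective-length : {A : Set} (xs xs′ : List A) {ys ys′ : List A} →
                      length xs ≡ length xs′ → xs ++ ys ≡ xs′ ++ ys′ → xs ≡ xs′ × ys ≡ ys′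
++-injective-length []       []         _    eq = refl , eq
++-injective-length (x ∷ xs) (x′ ∷ xs′) |xs| eq with ∷-injective eq
... | refl , eq′ with ++-injective-length xs xs′ (suc-injective |xs|) eq′
... | refl , refl = refl , refl

join-injective : ∀ {l} γ γ′ {δ δ′} → length γ ≡ length γ′ → join l γ δ ≡ join l γ′ δ′ → γ ≡ γ′ × δ ≡ δ′
join-injective {l} γ γ′ |γ|≡|γ′| eq
  with γ+≡ , δ≡ ← ++-injective-length (map (suc l +_) γ) (map (suc l +_) γ′)
                    (trans (length-map _ γ) (trans |γ|≡|γ′| (sym (length-map _ γ′)))) (∷-injectiveʳ eq)
  = map-injective (+-cancelˡ-≡ (suc l) _ _) γ+≡ , δ≡

No213From-split : ∀ x ρ → No213From x ρ → All (x ≢_) ρ →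
                  ∃[ γ′ ] ∃[ δ ] ρ ≡ γ′ ++ δ × All (x <_) γ′ × All (_< x) δ
No213From-split x []       _          _             = [] , [] , refl , [] , []
No213From-split x (y ∷ ys) (h , nys) (x≢y ∷ x≢ys) with x <? y
... | yes x<y with No213From-split x ys nys x≢ys
...   | γ′ , δ , refl , γ′> , δ< = y ∷ γ′ , δ , refl , x<y ∷ γ′> , δ<
No213From-split x (y ∷ ys) (h , nys) (x≢y ∷ x≢ys) | no x≮y =
  [] , y ∷ ys , refl , [] , y<x ∷ All.zipWith (λ (z≤x , x≢z) → ≤∧≢⇒< z≤x (x≢z ∘ sym)) (h y<x , x≢ys)
  where
  y<x : y < x
  y<x = ≤∧≢⇒< (≮⇒≥ x≮y) (x≢y ∘ sym)

record Decomposition (n : ℕ) (π : List ℕ) : Set where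
  constructor decomposition
  field
    {k l}  : ℕ
    {γ δ}  : List ℕ
    k+l≡n  : k + l ≡ n
    γ-av   : IsAv213 k γ
    δ-av   : IsAv213 l δ
    π≡join : π ≡ join l γ δ

-- After x = l + 1 come the entries above x, then those below x; the latter
-- form a permutation of [l] by the pigeonhole principle.
decompose : ∀ {n π} → IsAv213 (suc n) π → Decomposition n π
decompose {n} {suc l ∷ ρ} (perm@(|π|≡ , (x-range ∷ ρ-range) , (x∉ρ ∷ !ρ)) , (nx , aρ))
  with No213From-split (suc l) ρ nx x∉ρ
... | γ′ , δ , refl , γ′> , δ< =
  decomposition k+l≡n ((length-map _ γ′ , γ-range , Unique.map⁻ (subst Unique (sym γ≡) !γ′)) ,
                       Avoids213-shift⁻ x γ (subst Avoids213 (sym γ≡) (Avoids213-++⁻ˡ γ′ aρ)))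
                      ((|δ|≡l , All.zipWith (λ (z-range , z<x) → proj₁ z-range , ≤-pred z<x) (δ-range , δ<) , !δ) ,
                       Avoids213-++⁻ʳ γ′ aρ)
                      (cong (λ γ+ → x ∷ (γ+ ++ δ)) (sym γ≡))
  where
  x = suc l
  k = length γ′
  γ = map (_∸ x) γ′
  γ≡ : map (x +_) γ ≡ γ′
  γ≡ = trans (sym (map-∘ γ′)) (map-id-local (All.map (m+[n∸m]≡n ∘ <⇒≤) γ′>))
  !γ′ : Unique γ′
  !γ′ = proj₁ (Unique-++⁻ γ′ !ρ)
  !δ : Unique δ
  !δ = proj₂ (Unique-++⁻ γ′ !ρ)
  γ′-range : All (InRange (suc n)) γ′
  γ′-range = All.++⁻ˡ γ′ ρ-range
  δ-range : All (InRange (suc n)) δ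
  δ-range = All.++⁻ʳ γ′ ρ-range
  range1⊆δ : range1 l ⊆ δ
  range1⊆δ {z} z∈ with ∈-range1⁻ z∈
  ... | 0<z , z≤l
    with ∈-resp-↭ (↭-sym (permutation-↭ perm)) (∈-range1⁺ (0<z , ≤-trans z≤l (≤-trans (n≤1+n l) (proj₂ x-range))))
  ... | here z≡x  = ⊥-elim (<-irrefl z≡x (s≤s z≤l))
  ... | there z∈ρ with ∈-++⁻ γ′ z∈ρ
  ...   | inj₁ z∈γ′ = ⊥-elim (<-asym (s≤s z≤l) (All.lookup γ′> z∈γ′))
  ...   | inj₂ z∈δ  = z∈δ
  |δ|≡l : length δ ≡ l
  |δ|≡l = ≤-antisym (subst (length δ ≤_) (length-range1 l)
                              (Unique⇒length≤ !δ (λ z∈ → ∈-range1⁺ (proj₁ (All.lookup δ-range z∈) , ≤-pred (All.lookup δ< z∈)))))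
                    (subst (_≤ length δ) (length-range1 l) (Unique⇒length≤ (range1-unique l) range1⊆δ))
  k+l≡n : k + l ≡ n
  k+l≡n = suc-injective (trans (cong suc (trans (cong (k +_) (sym |δ|≡l)) (sym (length-++ γ′)))) |π|≡)
  γ-range : All (InRange k) γ
  γ-range = All.map⁺ (All.zipWith (λ (x<v , (_ , v≤)) → m<n⇒0<n∸m x<v , v∸x≤k v≤) (γ′> , γ′-range))
    where
    v∸x≤k : ∀ {v} → v ≤ suc n → v ∸ x ≤ k
    v∸x≤k {v} v≤ = subst (v ∸ x ≤_) (m+n∸n≡m k x)
                         (∸-monoˡ-≤ x (subst (v ≤_) (trans (cong suc (sym k+l≡n)) (sym (+-suc k l))) v≤))

join-IsAv213 : ∀ {k l γ δ} → IsAv213 k γ → IsAv213 l δ → IsAv213 (suc (k + l)) (join l γ δ)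
join-IsAv213 (γ-perm@(_ , γ-range , _) , aγ) (δ-perm@(_ , δ-range , _) , aδ) =
  join-permutation γ-perm δ-perm , join-avoids (All.map proj₁ γ-range) (All.map proj₂ δ-range) aγ aδ

private
  T⇒≡true : ∀ {b} → T b → b ≡ true
  T⇒≡true {true} _ = refl

  ≡true⇒T : ∀ {b} → b ≡ true → T b
  ≡true⇒T refl = _

  ¬T⇒≡false : ∀ {b} → ¬ T b → b ≡ false
  ¬T⇒≡false {false} _ = refl
  ¬T⇒≡false {true}  h = ⊥-elim (h _)

  <ᵇ-true⇒< : ∀ {m n} → (m <ᵇ n) ≡ true → m < n
  <ᵇ-true⇒< {m} {n} = <ᵇ⇒< m n ∘ ≡true⇒T

  <⇒<ᵇ-true : ∀ {m n} → m < n → (m <ᵇ n) ≡ true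
  <⇒<ᵇ-true = T⇒≡true ∘ <⇒<ᵇ

  ≡ᵇ-true⇒≡ : ∀ {m n} → (m ≡ᵇ n) ≡ true → m ≡ n
  ≡ᵇ-true⇒≡ {m} {n} = ≡ᵇ⇒≡ m n ∘ ≡true⇒T

  ≡⇒≡ᵇ-true : ∀ {m n} → m ≡ n → (m ≡ᵇ n) ≡ true
  ≡⇒≡ᵇ-true {m} {n} = T⇒≡true ∘ ≡⇒≡ᵇ m n

  ∧-true⁻ : ∀ {a b} → a ∧ b ≡ true → a ≡ true × b ≡ true
  ∧-true⁻ {true} {true} _ = refl , refl

allB-true⁻ : {A : Set} (p : A → Bool) (xs : List A) → allB p xs ≡ true → ∀ {x} → x ∈ xs → p x ≡ true
allB-true⁻ p (y ∷ xs) all-p (here refl) = proj₁ (∧-true⁻ {p y} all-p)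
allB-true⁻ p (y ∷ xs) all-p (there x∈)  = allB-true⁻ p xs (proj₂ (∧-true⁻ {p y} all-p)) x∈

allB-true⁺ : {A : Set} (p : A → Bool) (xs : List A) → (∀ {x} → x ∈ xs → p x ≡ true) → allB p xs ≡ true
allB-true⁺ p []       _   = refl
allB-true⁺ p (y ∷ xs) p-xs with p y | p-xs (here refl)
... | true | _ = allB-true⁺ p xs (p-xs ∘ there)

∈-words⁻ : ∀ m k {w} → w ∈ words m k → length w ≡ m × All (InRange k) w
∈-words⁻ zero    k (here refl) = refl , []
∈-words⁻ (suc m) k w∈ with find (∈-concatMap⁻ (λ w → map (_∷ w) (range1 k)) {words m k} w∈)
... | w , w∈′ , x∷w∈ with ∈-map⁻ (_∷ w) x∷w∈
... | x , x∈ , refl = cong suc (proj₁ (∈-words⁻ m k w∈′)) , ∈-range1⁻ x∈ ∷ proj₂ (∈-words⁻ m k w∈′)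

∈-words⁺ : ∀ m k {w} → length w ≡ m → All (InRange k) w → w ∈ words m k
∈-words⁺ zero    k {[]}    _     _              = here refl
∈-words⁺ (suc m) k {x ∷ w} |w|≡m (x-range ∷ w-range) =
  ∈-concatMap⁺ (λ w → map (_∷ w) (range1 k))
    (Any.map (λ { refl → ∈-map⁺ (_∷ w) (∈-range1⁺ x-range) }) (∈-words⁺ m k (suc-injective |w|≡m) w-range))

words-unique : ∀ m k → Unique (words m k)
words-unique zero    k = [] ∷ []
words-unique (suc m) k =
  concatMap-unique (λ w → map (_∷ w) (range1 k)) (words-unique m k)
    (λ _ → Unique.map⁺ ∷-injectiveˡ (range1-unique k))
    disjoint
  where
  disjoint : ∀ {w w′} → w ∈ words m k → w′ ∈ words m k → w ≢ w′ → Disjoint (map (_∷ w) (range1 k)) (map (_∷ w′) (range1 k))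
  disjoint _ _ w≢w′ (v∈ , v∈′) with ∈-map⁻ (_∷ _) v∈ | ∈-map⁻ (_∷ _) v∈′
  ... | _ , _ , refl | _ , _ , eq = w≢w′ (∷-injectiveʳ eq)

at-∈ : ∀ xs {q} → InRange (length xs) q → at xs q ∈ xs
at-∈ (x ∷ xs) {suc zero}    _              = here refl
at-∈ (x ∷ xs) {suc (suc q)} (_ , s≤s q≤n) = there (at-∈ xs (s≤s z≤n , q≤n))

∈⇒at : ∀ xs {z} → z ∈ xs → ∃[ q ] InRange (length xs) q × at xs q ≡ z
∈⇒at (x ∷ xs) (here refl) = 1 , (s≤s z≤n , s≤s z≤n) , refl
∈⇒at (x ∷ xs) (there z∈) with ∈⇒at xs z∈
... | suc q , (_ , q≤n) , eq = suc (suc q) , (s≤s z≤n , s≤s q≤n) , eq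

DistinctAt : List ℕ → Set
DistinctAt w = ∀ p q → InRange (length w) p → InRange (length w) q → p < q → at w p ≢ at w q

distinctB⇒DistinctAt : ∀ w → distinctB w ≡ true → DistinctAt w
distinctB⇒DistinctAt w dist p q p-range q-range p<q eq = clash (p <ᵇ q) (at w p ≡ᵇ at w q) test (<⇒<ᵇ-true p<q) (≡⇒≡ᵇ-true eq)
  where
  test : (not (p <ᵇ q) ∨ not (at w p ≡ᵇ at w q)) ≡ true
  test = allB-true⁻ _ (range1 (length w)) (allB-true⁻ _ (range1 (length w)) dist (∈-range1⁺ p-range)) (∈-range1⁺ q-range)
  clash : ∀ b₁ b₂ → (not b₁ ∨ not b₂) ≡ true → b₁ ≡ true → b₂ ≡ true → ⊥
  clash true true () refl refl

DistinctAt⇒distinctB : ∀ w → DistinctAt w → distinctB w ≡ true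
DistinctAt⇒distinctB w D =
  allB-true⁺ _ (range1 (length w)) λ {p} p∈ → allB-true⁺ _ (range1 (length w)) λ {q} q∈ →
    test p q (∈-range1⁻ p∈) (∈-range1⁻ q∈)
  where
  test : ∀ p q → InRange (length w) p → InRange (length w) q → (not (p <ᵇ q) ∨ not (at w p ≡ᵇ at w q)) ≡ true
  test p q p-range q-range with p <ᵇ q in p<q
  ... | false = refl
  ... | true with at w p ≡ᵇ at w q in eq
  ...   | false = refl
  ...   | true  = ⊥-elim (D p q p-range q-range (<ᵇ-true⇒< p<q) (≡ᵇ-true⇒≡ eq))

Unique⇒DistinctAt : ∀ w → Unique w → DistinctAt w
Unique⇒DistinctAt (x ∷ xs) (x∉ ∷ _)  (suc zero) (suc (suc q)) _ (_ , s≤s q≤n) _ = All.lookup x∉ (at-∈ xs (s≤s z≤n , q≤n))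
Unique⇒DistinctAt (x ∷ xs) (_ ∷ !xs) (suc (suc p)) (suc (suc q)) (_ , s≤s p≤n) (_ , s≤s q≤n) (s≤s p<q) =
  Unique⇒DistinctAt xs !xs (suc p) (suc q) (s≤s z≤n , p≤n) (s≤s z≤n , q≤n) p<q
Unique⇒DistinctAt []       _ (suc p) _ (_ , ()) _ _
Unique⇒DistinctAt (x ∷ xs) _ (suc zero)    (suc zero) _ _ (s≤s ())
Unique⇒DistinctAt (x ∷ xs) _ (suc (suc p)) (suc zero) _ _ (s≤s ())

DistinctAt⇒Unique : ∀ w → DistinctAt w → Unique w
DistinctAt⇒Unique []       _ = []
DistinctAt⇒Unique (x ∷ xs) D = All.tabulate x≢ ∷ DistinctAt⇒Unique xs D′
  where
  x≢ : ∀ {z} → z ∈ xs → x ≢ z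
  x≢ z∈ with ∈⇒at xs z∈
  ... | suc q , (_ , q≤n) , refl = D 1 (suc (suc q)) (s≤s z≤n , s≤s z≤n) (s≤s z≤n , s≤s q≤n) (s≤s (s≤s z≤n))
  D′ : DistinctAt xs
  D′ (suc p) (suc q) (_ , p≤n) (_ , q≤n) p<q = D (suc (suc p)) (suc (suc q)) (s≤s z≤n , s≤s p≤n) (s≤s z≤n , s≤s q≤n) (s≤s p<q)

Avoids213At : List ℕ → Set
Avoids213At w = ∀ p q r → InRange (length w) p → InRange (length w) q → InRange (length w) r →
                p < q → q < r → ¬ (at w q < at w p × at w p < at w r)

No213FromAt : ℕ → List ℕ → Set
No213FromAt x ys = ∀ q r → InRange (length ys) q → InRange (length ys) r → q < r → ¬ (at ys q < x × x < at ys r)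

avoids213B⇒Avoids213At : ∀ w → avoids213B w ≡ true → Avoids213At w
avoids213B⇒Avoids213At w av p q r p-range q-range r-range p<q q<r (wq<wp , wp<wr) =
  clash (p <ᵇ q) (q <ᵇ r) (at w q <ᵇ at w p) (at w p <ᵇ at w r) test
        (<⇒<ᵇ-true p<q) (<⇒<ᵇ-true q<r) (<⇒<ᵇ-true wq<wp) (<⇒<ᵇ-true wp<wr)
  where
  R = range1 (length w)
  test : not ((p <ᵇ q) ∧ (q <ᵇ r) ∧ (at w q <ᵇ at w p) ∧ (at w p <ᵇ at w r)) ≡ true
  test = allB-true⁻ _ R (allB-true⁻ _ R (allB-true⁻ _ R av (∈-range1⁺ p-range)) (∈-range1⁺ q-range)) (∈-range1⁺ r-range)
  clash : ∀ a b c d → not (a ∧ b ∧ c ∧ d) ≡ true → a ≡ true → b ≡ true → c ≡ true → d ≡ true → ⊥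
  clash true true true true () refl refl refl refl

Avoids213At⇒avoids213B : ∀ w → Avoids213At w → avoids213B w ≡ true
Avoids213At⇒avoids213B w A =
  allB-true⁺ _ R λ {p} p∈ → allB-true⁺ _ R λ {q} q∈ → allB-true⁺ _ R λ {r} r∈ →
    test (p <ᵇ q) (q <ᵇ r) (at w q <ᵇ at w p) (at w p <ᵇ at w r)
      (λ p<q q<r wq<wp wp<wr → A p q r (∈-range1⁻ p∈) (∈-range1⁻ q∈) (∈-range1⁻ r∈)
                                 (<ᵇ-true⇒< p<q) (<ᵇ-true⇒< q<r) (<ᵇ-true⇒< wq<wp , <ᵇ-true⇒< wp<wr))
  where
  R = range1 (length w)
  test : ∀ a b c d → (a ≡ true → b ≡ true → c ≡ true → d ≡ true → ⊥) → not (a ∧ b ∧ c ∧ d) ≡ true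
  test false b     c     d     _ = refl
  test true  false c     d     _ = refl
  test true  true  false d     _ = refl
  test true  true  true  false _ = refl
  test true  true  true  true  h = ⊥-elim (h refl refl refl refl)

No213FromAt⇒No213From : ∀ x ys → No213FromAt x ys → No213From x ys
No213FromAt⇒No213From x []       _ = _
No213FromAt⇒No213From x (y ∷ ys) N = (λ y<x → All.tabulate (≤x y<x)) , No213FromAt⇒No213From x ys N′
  where
  ≤x : y < x → ∀ {z} → z ∈ ys → z ≤ x
  ≤x y<x z∈ with ∈⇒at ys z∈
  ... | suc r , (_ , r≤n) , refl =
    ≮⇒≥ (λ x<z → N 1 (suc (suc r)) (s≤s z≤n , s≤s z≤n) (s≤s z≤n , s≤s r≤n) (s≤s (s≤s z≤n)) (y<x , x<z))
  N′ : No213FromAt x ys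
  N′ (suc q) (suc r) (_ , q≤n) (_ , r≤n) q<r = N (suc (suc q)) (suc (suc r)) (s≤s z≤n , s≤s q≤n) (s≤s z≤n , s≤s r≤n) (s≤s q<r)

No213From⇒No213FromAt : ∀ x ys → No213From x ys → No213FromAt x ys
No213From⇒No213FromAt x []       _         (suc q) r (_ , ()) _ _
No213From⇒No213FromAt x (y ∷ ys) (h , _)   (suc zero) (suc (suc r)) _ (_ , s≤s r≤n) _ (y<x , x<z) =
  <⇒≱ x<z (All.lookup (h y<x) (at-∈ ys (s≤s z≤n , r≤n)))
No213From⇒No213FromAt x (y ∷ ys) (_ , nys) (suc (suc q)) (suc (suc r)) (_ , s≤s q≤n) (_ , s≤s r≤n) (s≤s q<r) =
  No213From⇒No213FromAt x ys nys (suc q) (suc r) (s≤s z≤n , q≤n) (s≤s z≤n , r≤n) q<r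
No213From⇒No213FromAt x (y ∷ ys) _ (suc zero)    (suc zero) _ _ (s≤s ())
No213From⇒No213FromAt x (y ∷ ys) _ (suc (suc q)) (suc zero) _ _ (s≤s ())

Avoids213At⇒Avoids213 : ∀ w → Avoids213At w → Avoids213 w
Avoids213At⇒Avoids213 []       _ = _
Avoids213At⇒Avoids213 (x ∷ xs) A = No213FromAt⇒No213From x xs N , Avoids213At⇒Avoids213 xs A′
  where
  N : No213FromAt x xs
  N (suc q) (suc r) (_ , q≤n) (_ , r≤n) q<r =
    A 1 (suc (suc q)) (suc (suc r)) (s≤s z≤n , s≤s z≤n) (s≤s z≤n , s≤s q≤n) (s≤s z≤n , s≤s r≤n) (s≤s (s≤s z≤n)) (s≤s q<r)
  A′ : Avoids213At xs
  A′ (suc p) (suc q) (suc r) (_ , p≤n) (_ , q≤n) (_ , r≤n) p<q q<r =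
    A (suc (suc p)) (suc (suc q)) (suc (suc r)) (s≤s z≤n , s≤s p≤n) (s≤s z≤n , s≤s q≤n) (s≤s z≤n , s≤s r≤n) (s≤s p<q) (s≤s q<r)

Avoids213⇒Avoids213At : ∀ w → Avoids213 w → Avoids213At w
Avoids213⇒Avoids213At []       _ (suc p) q r (_ , ()) _ _ _ _
Avoids213⇒Avoids213At (x ∷ xs) (nx , _) (suc zero) (suc (suc q)) (suc (suc r)) _ (_ , s≤s q≤n) (_ , s≤s r≤n) _ (s≤s q<r) =
  No213From⇒No213FromAt x xs nx (suc q) (suc r) (s≤s z≤n , q≤n) (s≤s z≤n , r≤n) q<r
Avoids213⇒Avoids213At (x ∷ xs) (_ , axs) (suc (suc p)) (suc (suc q)) (suc (suc r))
                      (_ , s≤s p≤n) (_ , s≤s q≤n) (_ , s≤s r≤n) (s≤s p<q) (s≤s q<r) =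
  Avoids213⇒Avoids213At xs axs (suc p) (suc q) (suc r) (s≤s z≤n , p≤n) (s≤s z≤n , q≤n) (s≤s z≤n , r≤n) p<q q<r
Avoids213⇒Avoids213At (x ∷ xs) _ (suc zero)    (suc zero)    _          _ _ _ (s≤s ()) _
Avoids213⇒Avoids213At (x ∷ xs) _ (suc (suc p)) (suc zero)    _          _ _ _ (s≤s ()) _
Avoids213⇒Avoids213At (x ∷ xs) _ (suc zero)    (suc (suc q)) (suc zero) _ _ _ _ (s≤s ())
Avoids213⇒Avoids213At (x ∷ xs) _ (suc (suc p)) (suc (suc q)) (suc zero) _ _ _ _ (s≤s ())

∈-Av213⁻ : ∀ n {π} → π ∈ Av213 n → IsAv213 n π
∈-Av213⁻ n {π} π∈ with ∈-filter⁻ (λ w → avoids213B w ≟ᵇ true) {xs = Perms n} π∈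
... | π∈Perms , av with ∈-filter⁻ (λ w → distinctB w ≟ᵇ true) {xs = words n n} π∈Perms
... | π∈words , dist =
  (proj₁ (∈-words⁻ n n π∈words) , proj₂ (∈-words⁻ n n π∈words) , DistinctAt⇒Unique π (distinctB⇒DistinctAt π dist)) ,
  Avoids213At⇒Avoids213 π (avoids213B⇒Avoids213At π av)

∈-Av213⁺ : ∀ n {π} → IsAv213 n π → π ∈ Av213 n
∈-Av213⁺ n {π} ((|π|≡n , π-range , !π) , aπ) =
  ∈-filter⁺ (λ w → avoids213B w ≟ᵇ true) {xs = Perms n}
    (∈-filter⁺ (λ w → distinctB w ≟ᵇ true) {xs = words n n} (∈-words⁺ n n |π|≡n π-range)
               (DistinctAt⇒distinctB π (Unique⇒DistinctAt π !π)))
    (Avoids213At⇒avoids213B π (Avoids213⇒Avoids213At π aπ))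

Av213-unique : ∀ n → Unique (Av213 n)
Av213-unique n = Unique.filter⁺ (λ w → avoids213B w ≟ᵇ true) (Unique.filter⁺ (λ w → distinctB w ≟ᵇ true) (words-unique n n))

-- Recursive structure of Av213

joins : ℕ → ℕ → List (List ℕ)
joins k l = concatMap (λ γ → map (join l γ) (Av213 l)) (Av213 k)

decomposed : ℕ → List (List ℕ)
decomposed n = concatMap (λ (k , l) → joins k l) (splits n)

record JoinOf (k l : ℕ) (π : List ℕ) : Set where
  constructor joinOf
  field
    {γ δ}  : List ℕ
    γ∈     : γ ∈ Av213 k
    δ∈     : δ ∈ Av213 l
    π≡join : π ≡ join l γ δ

∈-joins⁻ : ∀ k l {π} → π ∈ joins k l → JoinOf k l π
∈-joins⁻ k l π∈ with find (∈-concatMap⁻ (λ γ → map (join l γ) (Av213 l)) {Av213 k} π∈)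
... | γ , γ∈ , π∈′ with ∈-map⁻ (join l γ) π∈′
... | δ , δ∈ , π≡ = joinOf γ∈ δ∈ π≡

∈-decomposed⁻ : ∀ n {π} → π ∈ decomposed n → ∃[ k ] ∃[ l ] (k , l) ∈ splits n × JoinOf k l π
∈-decomposed⁻ n π∈ with find (∈-concatMap⁻ _ {splits n} π∈)
... | (k , l) , kl∈ , π∈′ = k , l , kl∈ , ∈-joins⁻ k l π∈′

∈-decomposed⁺ : ∀ n {k l γ δ} → (k , l) ∈ splits n → γ ∈ Av213 k → δ ∈ Av213 l → join l γ δ ∈ decomposed n
∈-decomposed⁺ n {k} {l} {γ} {δ} kl∈ γ∈ δ∈ =
  ∈-concatMap⁺ _ (Any.map (λ { refl → ∈-concatMap⁺ (λ γ → map (join l γ) (Av213 l))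
                                        (Any.map (λ { refl → ∈-map⁺ (join l γ) δ∈ }) γ∈) }) kl∈)

length-∈-Av213 : ∀ n {π} → π ∈ Av213 n → length π ≡ n
length-∈-Av213 n π∈ = proj₁ (proj₁ (∈-Av213⁻ n π∈))

decomposed-unique : ∀ n → Unique (decomposed n)
decomposed-unique n = concatMap-unique _ (splits-unique n) (λ {(k , l)} _ → joins-unique k l) splits-disjoint
  where
  joins-unique : ∀ k l → Unique (joins k l)
  joins-unique k l =
    concatMap-unique (λ γ → map (join l γ) (Av213 l)) (Av213-unique k)
      (λ {γ} _ → Unique.map⁺ (λ eq → proj₂ (join-injective γ γ refl eq)) (Av213-unique l))
      (λ {γ} {γ′} γ∈ γ′∈ γ≢γ′ (π∈ , π∈′) → γs-disjoint γ∈ γ′∈ γ≢γ′ (∈-map⁻ (join l γ) π∈) (∈-map⁻ (join l γ′) π∈′))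
    where
    γs-disjoint : ∀ {γ γ′ π} → γ ∈ Av213 k → γ′ ∈ Av213 k → γ ≢ γ′ →
                  ∃[ δ ] δ ∈ Av213 l × π ≡ join l γ δ → ∃[ δ′ ] δ′ ∈ Av213 l × π ≡ join l γ′ δ′ → ⊥
    γs-disjoint {γ} {γ′} γ∈ γ′∈ γ≢γ′ (_ , _ , refl) (_ , _ , eq) =
      γ≢γ′ (proj₁ (join-injective γ γ′ (trans (length-∈-Av213 k γ∈) (sym (length-∈-Av213 k γ′∈))) eq))
  splits-disjoint : ∀ {p q} → p ∈ splits n → q ∈ splits n → p ≢ q → Disjoint (joins (proj₁ p) (proj₂ p)) (joins (proj₁ q) (proj₂ q))
  splits-disjoint {k , l} {k′ , l′} kl∈ kl′∈ kl≢kl′ (π∈ , π∈′)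
    with ∈-joins⁻ k l π∈ | ∈-joins⁻ k′ l′ π∈′
  ... | joinOf _ _ refl | joinOf _ _ eq = kl≢kl′ (cong₂ _,_ k≡k′ l≡l′)
    where
    l≡l′ : l ≡ l′
    l≡l′ = suc-injective (∷-injectiveˡ eq)
    k≡k′ : k ≡ k′
    k≡k′ = +-cancelʳ-≡ l k k′ (trans (∈-splits⁻ n kl∈) (sym (trans (cong (k′ +_) l≡l′) (∈-splits⁻ n kl′∈))))

Av213-suc-↭ : ∀ n → Av213 (suc n) ↭ decomposed n
Av213-suc-↭ n = unique-↭ (Av213-unique (suc n)) (decomposed-unique n) (mk⇔ to from)
  where
  to : ∀ {π} → π ∈ Av213 (suc n) → π ∈ decomposed n
  to π∈ with decomposition k+l≡n γ-av δ-av refl ← decompose (∈-Av213⁻ (suc n) π∈) =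
    ∈-decomposed⁺ n (∈-splits⁺ n k+l≡n) (∈-Av213⁺ _ γ-av) (∈-Av213⁺ _ δ-av)
  from : ∀ {π} → π ∈ decomposed n → π ∈ Av213 (suc n)
  from π∈ with k , l , kl∈ , joinOf γ∈ δ∈ refl ← ∈-decomposed⁻ n π∈ =
    ∈-Av213⁺ (suc n) (subst (λ m → IsAv213 (suc m) _) (∈-splits⁻ n kl∈) (join-IsAv213 (∈-Av213⁻ k γ∈) (∈-Av213⁻ l δ∈)))

sumMap-Av213-suc : ∀ n (g : List ℕ → ℕ) →
  sumMap (Av213 (suc n)) g ≡ convolve n (λ k l → sumMap (Av213 k) (λ γ → sumMap (Av213 l) (λ δ → g (join l γ δ))))
sumMap-Av213-suc n g = begin
  sumMap (Av213 (suc n)) g                               ≡⟨ sumMap-↭ g (Av213-suc-↭ n) ⟩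
  sumMap (decomposed n) g                                ≡⟨ sumMap-concatMap _ (splits n) g ⟩
  sumMap (splits n) (λ (k , l) → sumMap (joins k l) g)   ≡⟨ sumMap-cong (splits n) (λ (k , l) _ → sumMap-joins k l) ⟩
  sumMap (splits n) (uncurry λ k l → sumMap (Av213 k) (λ γ → sumMap (Av213 l) (λ δ → g (join l γ δ))))
                                                         ≡⟨ sumMap-splits n _ ⟩
  convolve n (λ k l → sumMap (Av213 k) (λ γ → sumMap (Av213 l) (λ δ → g (join l γ δ)))) ∎
  where
  sumMap-joins : ∀ k l → sumMap (joins k l) g ≡ sumMap (Av213 k) (λ γ → sumMap (Av213 l) (λ δ → g (join l γ δ)))
  sumMap-joins k l = trans (sumMap-concatMap _ (Av213 k) g) (sumMap-cong (Av213 k) (λ γ _ → sumMap-map (join l γ) (Av213 l) g))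

first : List ℕ → ℕ
first []      = 0
first (x ∷ _) = x

-- Since first [] = 0, the last entry contributes x ⊓ 0 = 0.
adjacentMins : List ℕ → ℕ
adjacentMins []       = 0
adjacentMins (x ∷ xs) = x ⊓ first xs + adjacentMins xs

adjacentMins-join : ∀ l γ δ → first δ ≤ suc l →
                    adjacentMins (join l γ δ) ≡ suc l * length γ + adjacentMins γ + adjacentMins δ + first δ
adjacentMins-join l γ δ δ₁≤b = go γ
  where
  b = suc l
  rest : List ℕ → List ℕ
  rest γ = map (b +_) γ ++ δ
  b+x⊓ : ∀ x γ → (b + x) ⊓ first (rest γ) ≡ b ⊓ first (rest γ) + x ⊓ first γ
  b+x⊓ x []      = begin
    (b + x) ⊓ first δ   ≡⟨ m≥n⇒m⊓n≡n (≤-trans δ₁≤b (m≤m+n b x)) ⟩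
    first δ             ≡⟨ sym (m≥n⇒m⊓n≡n δ₁≤b) ⟩
    b ⊓ first δ         ≡⟨ sym (+-identityʳ _) ⟩
    b ⊓ first δ + 0     ≡⟨ cong (b ⊓ first δ +_) (sym (⊓-zeroʳ x)) ⟩
    b ⊓ first δ + x ⊓ 0 ∎
  b+x⊓ x (y ∷ γ) = trans (sym (+-distribˡ-⊓ b x y)) (cong (_+ x ⊓ y) (sym (m≤n⇒m⊓n≡m (m≤m+n b y))))
  go : ∀ γ → b ⊓ first (rest γ) + adjacentMins (rest γ) ≡ b * length γ + adjacentMins γ + adjacentMins δ + first δ
  go []      = trans (cong (_+ adjacentMins δ) (m≥n⇒m⊓n≡n δ₁≤b)) (reorder (first δ) (adjacentMins δ) b)
    where
    reorder : ∀ f m b → f + m ≡ b * 0 + 0 + m + f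
    reorder = solve-∀
  go (x ∷ γ) = begin
    b ⊓ (b + x) + ((b + x) ⊓ first (rest γ) + adjacentMins (rest γ))
      ≡⟨ cong₂ (λ s t → s + (t + adjacentMins (rest γ))) (m≤n⇒m⊓n≡m (m≤m+n b x)) (b+x⊓ x γ) ⟩
    b + (b ⊓ first (rest γ) + x ⊓ first γ + adjacentMins (rest γ))
      ≡⟨ regroup b (b ⊓ first (rest γ)) (x ⊓ first γ) (adjacentMins (rest γ)) ⟩
    b + x ⊓ first γ + (b ⊓ first (rest γ) + adjacentMins (rest γ))
      ≡⟨ cong (b + x ⊓ first γ +_) (go γ) ⟩
    b + x ⊓ first γ + (b * length γ + adjacentMins γ + adjacentMins δ + first δ)
      ≡⟨ regroup₂ b (x ⊓ first γ) (length γ) (adjacentMins γ) (adjacentMins δ) (first δ) ⟩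
    b * suc (length γ) + (x ⊓ first γ + adjacentMins γ) + adjacentMins δ + first δ ∎
    where
    regroup : ∀ b p q r → b + (p + q + r) ≡ b + q + (p + r)
    regroup = solve-∀
    regroup₂ : ∀ b q n g m h → b + q + (b * n + g + m + h) ≡ b * suc n + (q + g) + m + h
    regroup₂ = solve-∀

length-Av213 : ∀ n → length (Av213 n) ≡ catalan n
length-Av213 = <-rec _ λ where
  zero    _   → refl
  (suc n) rec → begin
    length (Av213 (suc n))
      ≡⟨ length≡sumMap-1 (Av213 (suc n)) ⟩
    sumMap (Av213 (suc n)) (λ _ → 1)
      ≡⟨ sumMap-Av213-suc n (λ _ → 1) ⟩
    convolve n (λ k l → sumMap (Av213 k) (λ _ → sumMap (Av213 l) (λ _ → 1)))
      ≡⟨ convolve-cong n (λ k l k+l≡n → begin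
           sumMap (Av213 k) (λ _ → sumMap (Av213 l) (λ _ → 1))
             ≡⟨ sumMap-const (Av213 k) _ ⟩
           length (Av213 k) * sumMap (Av213 l) (λ _ → 1)
             ≡⟨ cong₂ (λ s t → s * t) (rec {k} (s≤s (proj₁ (summands-≤ k+l≡n))))
                                     (trans (sym (length≡sumMap-1 (Av213 l))) (rec {l} (s≤s (proj₂ (summands-≤ k+l≡n))))) ⟩
           catalan k * catalan l ∎) ⟩
    convolve n (λ k l → catalan k * catalan l)
      ≡⟨ sym (catalan-suc n) ⟩
    catalan (suc n) ∎

sumMap-Av213-const² : ∀ k l c → sumMap (Av213 k) (λ _ → sumMap (Av213 l) (λ _ → c)) ≡ catalan k * (catalan l * c)
sumMap-Av213-const² k l c = begin
  sumMap (Av213 k) (λ _ → sumMap (Av213 l) (λ _ → c)) ≡⟨ sumMap-const (Av213 k) _ ⟩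
  length (Av213 k) * sumMap (Av213 l) (λ _ → c)      ≡⟨ cong (length (Av213 k) *_) (sumMap-const (Av213 l) c) ⟩
  length (Av213 k) * (length (Av213 l) * c)          ≡⟨ cong₂ (λ s t → s * (t * c)) (length-Av213 k) (length-Av213 l) ⟩
  catalan k * (catalan l * c)                        ∎

first-Av213 : ∀ n → sumMap (Av213 n) first ≡ firstEntryTotal n
first-Av213 zero    = refl
first-Av213 (suc n) = trans (sumMap-Av213-suc n first) (convolve-cong n (λ k l _ →
  trans (sumMap-Av213-const² k l (suc l)) (reorder (catalan k) (catalan l) (suc l))))
  where
  reorder : ∀ x y s → x * (y * s) ≡ s * (x * y)
  reorder = solve-∀

first-≤ : ∀ {l δ} → IsPermutation l δ → first δ ≤ l
first-≤ {δ = []}    _                       = z≤n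
first-≤ {δ = x ∷ _} (_ , (_ , x≤l) ∷ _ , _) = x≤l

adjacentMins-Av213 : ∀ n → 2 * sumMap (Av213 n) adjacentMins + 2 * deficit n ≡ catalan n * (n * suc n)
adjacentMins-Av213 = <-rec _ step
  where
  X : ℕ → ℕ
  X k = sumMap (Av213 k) adjacentMins
  P : ℕ → Set
  P n = 2 * X n + 2 * deficit n ≡ catalan n * (n * suc n)
  joins-total : ∀ k l →
    sumMap (Av213 k) (λ γ → sumMap (Av213 l) (λ δ → adjacentMins (join l γ δ)))
      ≡ suc l * k * (catalan k * catalan l) + X k * catalan l + catalan k * X l + catalan k * firstEntryTotal l
  joins-total k l = begin
    sumMap (Av213 k) (λ γ → sumMap (Av213 l) (λ δ → adjacentMins (join l γ δ)))
      ≡⟨ sumMap-cong (Av213 k) (λ γ γ∈ → sumMap-cong (Av213 l) (λ δ δ∈ → adjacentMins-join-∈ γ∈ δ∈)) ⟩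
    sumMap (Av213 k) (λ γ → sumMap (Av213 l) (λ δ → (suc l * k + adjacentMins γ) + (adjacentMins δ + first δ)))
      ≡⟨ sumMap²-+ (Av213 k) (Av213 l) _ _ ⟩
    length (Av213 l) * sumMap (Av213 k) (λ γ → suc l * k + adjacentMins γ)
      + length (Av213 k) * sumMap (Av213 l) (λ δ → adjacentMins δ + first δ)
      ≡⟨ cong₂ (λ s t → length (Av213 l) * s + length (Av213 k) * t)
               (trans (sumMap-+ (Av213 k) _ _) (cong (_+ X k) (sumMap-const (Av213 k) _)))
               (trans (sumMap-+ (Av213 l) _ _) (cong (X l +_) (first-Av213 l))) ⟩
    length (Av213 l) * (length (Av213 k) * (suc l * k) + X k) + length (Av213 k) * (X l + firstEntryTotal l)
      ≡⟨ cong₂ (λ s t → s * (t * (suc l * k) + X k) + t * (X l + firstEntryTotal l)) (length-Av213 l) (length-Av213 k) ⟩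
    catalan l * (catalan k * (suc l * k) + X k) + catalan k * (X l + firstEntryTotal l)
      ≡⟨ expand (catalan k) (catalan l) (suc l) k (X k) (X l) (firstEntryTotal l) ⟩
    suc l * k * (catalan k * catalan l) + X k * catalan l + catalan k * X l + catalan k * firstEntryTotal l ∎
    where
    adjacentMins-join-∈ : ∀ {γ δ} → γ ∈ Av213 k → δ ∈ Av213 l →
                         adjacentMins (join l γ δ) ≡ (suc l * k + adjacentMins γ) + (adjacentMins δ + first δ)
    adjacentMins-join-∈ {γ} {δ} γ∈ δ∈ = begin
      adjacentMins (join l γ δ)
        ≡⟨ adjacentMins-join l γ δ (m≤n⇒m≤1+n (first-≤ (proj₁ (∈-Av213⁻ l δ∈)))) ⟩
      suc l * length γ + adjacentMins γ + adjacentMins δ + first δ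
        ≡⟨ cong (λ t → suc l * t + adjacentMins γ + adjacentMins δ + first δ) (length-∈-Av213 k γ∈) ⟩
      suc l * k + adjacentMins γ + adjacentMins δ + first δ
        ≡⟨ +-assoc (suc l * k + adjacentMins γ) (adjacentMins δ) (first δ) ⟩
      (suc l * k + adjacentMins γ) + (adjacentMins δ + first δ) ∎
    expand : ∀ ck cl s k xk xl h → cl * (ck * (s * k) + xk) + ck * (xl + h) ≡ s * k * (ck * cl) + xk * cl + ck * xl + ck * h
    expand = solve-∀
  step : ∀ n → (∀ {m} → m < n → P m) → P n
  step zero    _   = refl
  step (suc n) rec = begin
    2 * X (suc n) + 2 * 4 ^ n
      ≡⟨ cong (λ t → 2 * t + 2 * 4 ^ n) (trans (sumMap-Av213-suc n adjacentMins) (convolve-cong n (λ k l _ → joins-total k l))) ⟩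
    2 * convolve n (λ k l → suc l * k * (catalan k * catalan l) + X k * catalan l + catalan k * X l
                            + catalan k * firstEntryTotal l) + 2 * 4 ^ n
      ≡⟨ adjacentMinsTotal-step n X (λ k k≤n → rec {k} (s≤s k≤n)) ⟩
    catalan (suc n) * (suc n * suc (suc n)) ∎

-- The grid graph

ind : Bool → ℕ
ind b = if b then 1 else 0

count≡sumMap : {A : Set} (p : A → Bool) (xs : List A) → count p xs ≡ sumMap xs (λ x → ind (p x))
count≡sumMap p []       = refl
count≡sumMap p (x ∷ xs) = cong (ind (p x) +_) (count≡sumMap p xs)

sumMap-gridV : ∀ π (G : ℕ × ℕ → ℕ) → sumMap (gridV π) G ≡ sumTo (length π) (λ i → sumTo (at π i) (λ j → G (i , j)))
sumMap-gridV π G = begin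
  sumMap (gridV π) G
    ≡⟨ sumMap-concatMap (λ i → map (i ,_) (range1 (at π i))) (range1 (length π)) G ⟩
  sumMap (range1 (length π)) (λ i → sumMap (map (i ,_) (range1 (at π i))) G)
    ≡⟨ sumMap-cong (range1 (length π)) (λ i _ → trans (sumMap-map (i ,_) (range1 (at π i)) G) (sumMap-range1 (at π i) _)) ⟩
  sumMap (range1 (length π)) (λ i → sumTo (at π i) (λ j → G (i , j)))
    ≡⟨ sumMap-range1 (length π) _ ⟩
  sumTo (length π) (λ i → sumTo (at π i) (λ j → G (i , j))) ∎

∈-gridV⁻ : ∀ π {v} → v ∈ gridV π → ∃[ i ] ∃[ j ] InRange (length π) i × InRange (at π i) j × v ≡ (i , j)
∈-gridV⁻ π v∈ with find (∈-concatMap⁻ (λ i → map (i ,_) (range1 (at π i))) {range1 (length π)} v∈)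
... | i , i∈ , v∈′ with ∈-map⁻ (i ,_) v∈′
... | j , j∈ , refl = i , j , ∈-range1⁻ i∈ , ∈-range1⁻ j∈ , refl

length-gridV : ∀ π → length (gridV π) ≡ sum π
length-gridV π = begin
  length (gridV π)                           ≡⟨ length≡sumMap-1 (gridV π) ⟩
  sumMap (gridV π) (λ _ → 1)                 ≡⟨ sumMap-gridV π (λ _ → 1) ⟩
  sumTo (length π) (λ i → sumTo (at π i) (λ _ → 1))
    ≡⟨ sumTo-cong (length π) (λ i _ _ → trans (sumTo-const (at π i) 1) (*-identityʳ _)) ⟩
  sumTo (length π) (at π)                    ≡⟨ sumTo-at-id π ⟩
  sum π                                      ∎

ind≤1 : ∀ b → ind b ≤ 1
ind≤1 false = z≤n
ind≤1 true  = ≤-refl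

ind-≡ᵇ-≢ : ∀ {x y} → x ≢ y → ind (x ≡ᵇ y) ≡ 0
ind-≡ᵇ-≢ {x} {y} x≢y = cong ind (¬T⇒≡false (x≢y ∘ ≡ᵇ⇒≡ x y))

ind-≡ᵇ-≡ : ∀ {x y} → x ≡ y → ind (x ≡ᵇ y) ≡ 1
ind-≡ᵇ-≡ {x} {y} x≡y = cong ind (T⇒≡true (≡⇒≡ᵇ x y x≡y))

ind-<ᵇ-≮ : ∀ {x y} → ¬ x < y → ind (x <ᵇ y) ≡ 0
ind-<ᵇ-≮ {x} {y} x≮y = cong ind (¬T⇒≡false (λ t → x≮y (<ᵇ⇒< x y t)))

ind-<ᵇ-< : ∀ {x y} → x < y → ind (x <ᵇ y) ≡ 1
ind-<ᵇ-< x<y = cong ind (T⇒≡true (<⇒<ᵇ x<y))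

ind-≤ᵇ-≤ : ∀ {x y} → x ≤ y → ind (x ≤ᵇ y) ≡ 1
ind-≤ᵇ-≤ x≤y = cong ind (T⇒≡true (≤⇒≤ᵇ x≤y))

ind-≤ᵇ-≰ : ∀ {x y} → ¬ x ≤ y → ind (x ≤ᵇ y) ≡ 0
ind-≤ᵇ-≰ {x} {y} x≰y = cong ind (¬T⇒≡false (λ t → x≰y (≤ᵇ⇒≤ x y t)))

∣n-1+n∣≡1 : ∀ n → ∣ n - suc n ∣ ≡ 1
∣n-1+n∣≡1 zero    = refl
∣n-1+n∣≡1 (suc n) = ∣n-1+n∣≡1 n

∣m-n∣≡1⇒ : ∀ m n → ∣ m - n ∣ ≡ 1 → n ≡ suc m ⊎ m ≡ suc n
∣m-n∣≡1⇒ zero    n       eq = inj₁ eq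
∣m-n∣≡1⇒ (suc m) zero    eq = inj₂ (cong suc (suc-injective eq))
∣m-n∣≡1⇒ (suc m) (suc n) eq with ∣m-n∣≡1⇒ m n eq
... | inj₁ n≡1+m = inj₁ (cong suc n≡1+m)
... | inj₂ m≡1+n = inj₂ (cong suc m≡1+n)

ind-∣-∣≡ᵇ1-0 : ∀ {x y} → y ≢ suc x → x ≢ suc y → ind (∣ x - y ∣ ≡ᵇ 1) ≡ 0
ind-∣-∣≡ᵇ1-0 {x} {y} y≢1+x x≢1+y = ind-≡ᵇ-≢ (neither ∘ ∣m-n∣≡1⇒ x y)
  where
  neither : ¬ (y ≡ suc x ⊎ x ≡ suc y)
  neither (inj₁ y≡1+x) = y≢1+x y≡1+x
  neither (inj₂ x≡1+y) = x≢1+y x≡1+y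

sumTo-ind-≡ᵇ : ∀ m x (G : ℕ → ℕ) → 1 ≤ x → x ≤ m → sumTo m (λ y → ind (x ≡ᵇ y) * G y) ≡ G x
sumTo-ind-≡ᵇ zero    x G 1≤x x≤0 = ⊥-elim (<-irrefl refl (≤-trans 1≤x x≤0))
sumTo-ind-≡ᵇ (suc m) x G 1≤x x≤m with x ≤? m
... | yes x≤m′ = trans (cong₂ _+_ (sumTo-ind-≡ᵇ m x G 1≤x x≤m′) (cong (_* G (suc m)) (ind-≡ᵇ-≢ (λ x≡ → <-irrefl x≡ (s≤s x≤m′)))))
                       (+-identityʳ (G x))
... | no  x≰m  with ≤-antisym x≤m (≰⇒> x≰m)
... | refl = trans (cong₂ _+_ (sumTo-zero m (λ y _ y≤m → cong (_* G y) (ind-≡ᵇ-≢ (λ 1+m≡y → <-irrefl (sym 1+m≡y) (s≤s y≤m)))))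
                              (cong (_* G (suc m)) (ind-≡ᵇ-≡ {suc m} refl)))
                   (+-identityʳ (G (suc m)))

sumTo-ind-≡ᵇ-count : ∀ m x → 1 ≤ x → sumTo m (λ y → ind (x ≡ᵇ y)) ≡ ind (x ≤ᵇ m)
sumTo-ind-≡ᵇ-count m x 1≤x with x ≤? m
... | yes x≤m = trans (sumTo-cong m (λ y _ _ → sym (*-identityʳ (ind (x ≡ᵇ y)))))
                      (trans (sumTo-ind-≡ᵇ m x (λ _ → 1) 1≤x x≤m) (sym (ind-≤ᵇ-≤ x≤m)))
... | no  x≰m = trans (sumTo-zero m (λ y _ y≤m → ind-≡ᵇ-≢ (λ x≡y → x≰m (subst (_≤ m) (sym x≡y) y≤m)))) (sym (ind-≤ᵇ-≰ x≰m))

sumTo-neighbours : ∀ m x (G : ℕ → ℕ) → 1 ≤ x → x ≤ m →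
  sumTo m (λ y → ind (∣ x - y ∣ ≡ᵇ 1) * G y) ≡ ind (2 ≤ᵇ x) * G (x ∸ 1) + ind (x <ᵇ m) * G (suc x)
sumTo-neighbours zero     x G 1≤x x≤0 = ⊥-elim (<-irrefl refl (≤-trans 1≤x x≤0))
sumTo-neighbours (suc m′) x G 1≤x x≤m with <-cmp x m′
... | tri< x<m′ _ _ = begin
  sumTo m′ (λ y → ind (∣ x - y ∣ ≡ᵇ 1) * G y) + ind (∣ x - suc m′ ∣ ≡ᵇ 1) * G (suc m′)
    ≡⟨ cong₂ _+_ (sumTo-neighbours m′ x G 1≤x (<⇒≤ x<m′))
                 (cong (_* G (suc m′)) (ind-∣-∣≡ᵇ1-0 (λ eq → <⇒≢ x<m′ (sym (suc-injective eq)))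
                                                    (λ eq → <⇒≢ (m<n⇒m<1+n (m<n⇒m<1+n x<m′)) eq))) ⟩
  ind (2 ≤ᵇ x) * G (x ∸ 1) + ind (x <ᵇ m′) * G (suc x) + 0
    ≡⟨ cong (λ t → ind (2 ≤ᵇ x) * G (x ∸ 1) + t * G (suc x) + 0) (trans (ind-<ᵇ-< x<m′) (sym (ind-<ᵇ-< (m<n⇒m<1+n x<m′)))) ⟩
  ind (2 ≤ᵇ x) * G (x ∸ 1) + ind (x <ᵇ suc m′) * G (suc x) + 0
    ≡⟨ +-identityʳ _ ⟩
  ind (2 ≤ᵇ x) * G (x ∸ 1) + ind (x <ᵇ suc m′) * G (suc x) ∎
... | tri≈ _ refl _ = begin
  sumTo x (λ y → ind (∣ x - y ∣ ≡ᵇ 1) * G y) + ind (∣ x - suc x ∣ ≡ᵇ 1) * G (suc x)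
    ≡⟨ cong₂ _+_ (sumTo-neighbours x x G 1≤x ≤-refl) (cong (_* G (suc x)) (ind-≡ᵇ-≡ (∣n-1+n∣≡1 x))) ⟩
  ind (2 ≤ᵇ x) * G (x ∸ 1) + ind (x <ᵇ x) * G (suc x) + 1 * G (suc x)
    ≡⟨ cong (λ t → ind (2 ≤ᵇ x) * G (x ∸ 1) + t * G (suc x) + 1 * G (suc x)) (ind-<ᵇ-≮ {x} (<-irrefl refl)) ⟩
  ind (2 ≤ᵇ x) * G (x ∸ 1) + 0 + 1 * G (suc x)
    ≡⟨ cong₂ _+_ (+-identityʳ _) (cong (_* G (suc x)) (sym (ind-<ᵇ-< (n<1+n x)))) ⟩
  ind (2 ≤ᵇ x) * G (x ∸ 1) + ind (x <ᵇ suc x) * G (suc x) ∎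
... | tri> _ _ m′<x with ≤-antisym x≤m m′<x
... | refl = cong₂ _+_
  (sumTo-zero-left m′)
  (trans (cong (λ t → ind (t ≡ᵇ 1) * G (suc m′)) (∣n-n∣≡0 m′)) (sym (cong (_* G (suc (suc m′))) (ind-<ᵇ-≮ {suc m′} (<-irrefl refl)))))
  where
  sumTo-zero-left : ∀ m → sumTo m (λ y → ind (∣ suc m - y ∣ ≡ᵇ 1) * G y) ≡ ind (2 ≤ᵇ suc m) * G m
  sumTo-zero-left zero    = refl
  sumTo-zero-left (suc m) = cong₂ _+_
    (sumTo-zero m (λ y _ y≤m → cong (_* G y) (ind-∣-∣≡ᵇ1-0 (λ eq → <⇒≢ (m<n⇒m<1+n (m<n⇒m<1+n (s≤s y≤m))) eq)
                                                          (λ eq → <⇒≢ (s≤s y≤m) (sym (suc-injective eq))))))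
    (cong (_* G (suc m)) (ind-≡ᵇ-≡ (trans (∣-∣-comm (suc (suc m)) (suc m)) (∣n-1+n∣≡1 (suc m)))))

sumTo-ind-≤ᵇ : ∀ m k → sumTo m (λ j → ind (j ≤ᵇ k)) ≡ m ⊓ k
sumTo-ind-≤ᵇ zero    k = refl
sumTo-ind-≤ᵇ (suc m) k with suc m ≤? k
... | yes 1+m≤k = trans (cong₂ _+_ (trans (sumTo-ind-≤ᵇ m k) (m≤n⇒m⊓n≡m (≤-trans (n≤1+n m) 1+m≤k))) (ind-≤ᵇ-≤ 1+m≤k))
                        (trans (+-comm m 1) (sym (m≤n⇒m⊓n≡m 1+m≤k)))
... | no  1+m≰k = trans (cong₂ _+_ (trans (sumTo-ind-≤ᵇ m k) (m≥n⇒m⊓n≡n (≤-pred (≰⇒> 1+m≰k)))) (ind-≤ᵇ-≰ 1+m≰k))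
                        (trans (+-identityʳ k) (sym (m≥n⇒m⊓n≡n (<⇒≤ (≰⇒> 1+m≰k)))))

sumTo-ind-2≤ᵇ : ∀ m → sumTo m (λ j → ind (2 ≤ᵇ j)) ≡ m ∸ 1
sumTo-ind-2≤ᵇ zero          = refl
sumTo-ind-2≤ᵇ (suc zero)    = refl
sumTo-ind-2≤ᵇ (suc (suc m)) = trans (cong (_+ 1) (sumTo-ind-2≤ᵇ (suc m))) (+-comm m 1)

sumTo-ind-<ᵇ : ∀ m → sumTo m (λ j → ind (j <ᵇ m)) ≡ m ∸ 1
sumTo-ind-<ᵇ zero    = refl
sumTo-ind-<ᵇ (suc m) = begin
  sumTo m (λ j → ind (j <ᵇ suc m)) + ind (suc m <ᵇ suc m)
    ≡⟨ cong₂ _+_ (sumTo-cong m (λ j _ j≤m → ind-<ᵇ-< (s≤s j≤m))) (ind-<ᵇ-≮ {suc m} (<-irrefl refl)) ⟩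
  sumTo m (λ _ → 1) + 0  ≡⟨ +-identityʳ _ ⟩
  sumTo m (λ _ → 1)      ≡⟨ sumTo-const m 1 ⟩
  m * 1                  ≡⟨ *-identityʳ m ⟩
  m                      ∎

-- The two disjuncts of adjB exclude each other.
ind-adjB : ∀ i j i′ j′ → ind (adjB (i , j) (i′ , j′)) ≡ ind (i ≡ᵇ i′) * ind (∣ j - j′ ∣ ≡ᵇ 1) + ind (∣ i - i′ ∣ ≡ᵇ 1) * ind (j ≡ᵇ j′)
ind-adjB i j i′ j′ with i ≟ i′
... | yes refl rewrite T⇒≡true (≡⇒≡ᵇ i i refl) | ∣n-n∣≡0 i with ∣ j - j′ ∣ ≡ᵇ 1
...   | true  = refl
...   | false = refl
ind-adjB i j i′ j′ | no i≢i′ rewrite ¬T⇒≡false (i≢i′ ∘ ≡ᵇ⇒≡ i i′) with ∣ i - i′ ∣ ≡ᵇ 1 | j ≡ᵇ j′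
...   | true  | true  = refl
...   | true  | false = refl
...   | false | _     = refl

deg-formula : ∀ π i j → 1 ≤ i → i ≤ length π → 1 ≤ j → j ≤ at π i →
  deg π (i , j) ≡ (ind (2 ≤ᵇ j) + ind (j <ᵇ at π i))
                  + (ind (2 ≤ᵇ i) * ind (j ≤ᵇ at π (i ∸ 1)) + ind (i <ᵇ length π) * ind (j ≤ᵇ at π (suc i)))
deg-formula π i j 1≤i i≤n 1≤j j≤πᵢ = begin
  count (adjB (i , j)) (gridV π)
    ≡⟨ count≡sumMap (adjB (i , j)) (gridV π) ⟩
  sumMap (gridV π) (λ v → ind (adjB (i , j) v))
    ≡⟨ sumMap-gridV π (λ v → ind (adjB (i , j) v)) ⟩
  sumTo n (λ i′ → sumTo (at π i′) (λ j′ → ind (adjB (i , j) (i′ , j′))))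
    ≡⟨ sumTo-cong n (λ i′ _ _ → split i′) ⟩
  sumTo n (λ i′ → ind (i ≡ᵇ i′) * vert i′ + ind (∣ i - i′ ∣ ≡ᵇ 1) * horiz i′)
    ≡⟨ sumTo-+ n _ _ ⟩
  sumTo n (λ i′ → ind (i ≡ᵇ i′) * vert i′) + sumTo n (λ i′ → ind (∣ i - i′ ∣ ≡ᵇ 1) * horiz i′)
    ≡⟨ cong₂ _+_ (sumTo-ind-≡ᵇ n i vert 1≤i i≤n)
                 (sumTo-cong n (λ i′ _ _ → cong (ind (∣ i - i′ ∣ ≡ᵇ 1) *_) (sumTo-ind-≡ᵇ-count (at π i′) j 1≤j))) ⟩
  vert i + sumTo n (λ i′ → ind (∣ i - i′ ∣ ≡ᵇ 1) * ind (j ≤ᵇ at π i′))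
    ≡⟨ cong₂ _+_ vertical (sumTo-neighbours n i (λ i′ → ind (j ≤ᵇ at π i′)) 1≤i i≤n) ⟩
  (ind (2 ≤ᵇ j) + ind (j <ᵇ at π i))
    + (ind (2 ≤ᵇ i) * ind (j ≤ᵇ at π (i ∸ 1)) + ind (i <ᵇ n) * ind (j ≤ᵇ at π (suc i))) ∎
  where
  n = length π
  vert horiz : ℕ → ℕ
  vert i′ = sumTo (at π i′) (λ j′ → ind (∣ j - j′ ∣ ≡ᵇ 1))
  horiz i′ = sumTo (at π i′) (λ j′ → ind (j ≡ᵇ j′))
  split : ∀ i′ → sumTo (at π i′) (λ j′ → ind (adjB (i , j) (i′ , j′))) ≡ ind (i ≡ᵇ i′) * vert i′ + ind (∣ i - i′ ∣ ≡ᵇ 1) * horiz i′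
  split i′ = trans (sumTo-cong (at π i′) (λ j′ _ _ → ind-adjB i j i′ j′))
                   (trans (sumTo-+ (at π i′) _ _) (cong₂ _+_ (sumTo-* (at π i′) (ind (i ≡ᵇ i′)) _) (sumTo-* (at π i′) (ind (∣ i - i′ ∣ ≡ᵇ 1)) _)))
  vertical : vert i ≡ ind (2 ≤ᵇ j) + ind (j <ᵇ at π i)
  vertical = trans (sumTo-cong (at π i) (λ j′ _ _ → sym (*-identityʳ _)))
                   (trans (sumTo-neighbours (at π i) j (λ _ → 1) 1≤j j≤πᵢ)
                          (cong₂ _+_ (*-identityʳ (ind (2 ≤ᵇ j))) (*-identityʳ (ind (j <ᵇ at π i)))))

minAdj≡sumTo : ∀ π → minAdj π ≡ sumTo (length π ∸ 1) (λ t → at π t ⊓ at π (suc t))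
minAdj≡sumTo π = sumMap-range1 (length π ∸ 1) (λ t → at π t ⊓ at π (suc t))

minAdj≡adjacentMins : ∀ π → minAdj π ≡ adjacentMins π
minAdj≡adjacentMins []          = refl
minAdj≡adjacentMins (x ∷ [])    = sym (trans (+-identityʳ (x ⊓ 0)) (⊓-zeroʳ x))
minAdj≡adjacentMins (x ∷ y ∷ π) = begin
  minAdj (x ∷ y ∷ π)
    ≡⟨ minAdj≡sumTo (x ∷ y ∷ π) ⟩
  sumTo (suc (length π)) (λ t → at (x ∷ y ∷ π) t ⊓ at (x ∷ y ∷ π) (suc t))
    ≡⟨ sumTo-suc (length π) _ ⟩
  x ⊓ y + sumTo (length π) (λ t → at (x ∷ y ∷ π) (suc t) ⊓ at (x ∷ y ∷ π) (suc (suc t)))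
    ≡⟨ cong (x ⊓ y +_) (sumTo-cong (length π) (λ { (suc t) _ _ → refl })) ⟩
  x ⊓ y + sumTo (length π) (λ t → at (y ∷ π) t ⊓ at (y ∷ π) (suc t))
    ≡⟨ cong (x ⊓ y +_) (trans (sym (minAdj≡sumTo (y ∷ π))) (minAdj≡adjacentMins (y ∷ π))) ⟩
  x ⊓ y + adjacentMins (y ∷ π) ∎

sumTo-mins-left : ∀ n (f : ℕ → ℕ) → sumTo n (λ i → ind (2 ≤ᵇ i) * (f i ⊓ f (i ∸ 1))) ≡ sumTo (n ∸ 1) (λ t → f t ⊓ f (suc t))
sumTo-mins-left zero    f = refl
sumTo-mins-left (suc n) f =
  trans (sumTo-suc n _) (sumTo-cong n (λ { (suc t) _ _ → trans (+-identityʳ _) (⊓-comm (f (suc (suc t))) (f (suc t))) }))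

sumTo-mins-right : ∀ n (f : ℕ → ℕ) → sumTo n (λ i → ind (i <ᵇ n) * (f i ⊓ f (suc i))) ≡ sumTo (n ∸ 1) (λ t → f t ⊓ f (suc t))
sumTo-mins-right zero    f = refl
sumTo-mins-right (suc n) f =
  trans (cong₂ _+_ (sumTo-cong n (λ t _ t≤n → trans (cong (_* (f t ⊓ f (suc t))) (ind-<ᵇ-< (s≤s t≤n))) (+-identityʳ _)))
                   (cong (_* (f (suc n) ⊓ f (suc (suc n)))) (ind-<ᵇ-≮ {suc n} (<-irrefl refl))))
        (+-identityʳ _)

positive-at : ∀ π → All (0 <_) π → ∀ i → 1 ≤ i → i ≤ length π → 1 ≤ at π i
positive-at π π>0 i 1≤i i≤n = All.lookup π>0 (at-∈ π (1≤i , i≤n))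

degreeSum : ∀ π → All (0 <_) π → sum (map (deg π) (gridV π)) + 2 * length π ≡ 2 * sum π + 2 * minAdj π
degreeSum π π>0 = begin
  sumMap (gridV π) (deg π) + 2 * n
    ≡⟨ cong (_+ 2 * n) (trans (sumMap-gridV π (deg π)) (sumTo-cong n column)) ⟩
  sumTo n (λ i → D i + (L i + R i)) + 2 * n
    ≡⟨ cong (_+ 2 * n) (trans (sumTo-+ n D _) (cong (sumTo n D +_) (sumTo-+ n L R))) ⟩
  sumTo n D + (sumTo n L + sumTo n R) + 2 * n
    ≡⟨ cong (λ t → sumTo n D + t + 2 * n) (cong₂ _+_ (sumTo-mins-left n (at π)) (sumTo-mins-right n (at π))) ⟩
  sumTo n D + (m + m) + 2 * n
    ≡⟨ regroup (sumTo n D) m (2 * n) ⟩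
  (sumTo n D + 2 * n) + 2 * m
    ≡⟨ cong₂ (λ s t → s + 2 * t) vertical (sym (minAdj≡sumTo π)) ⟩
  2 * sum π + 2 * minAdj π ∎
  where
  n = length π
  m = sumTo (n ∸ 1) (λ t → at π t ⊓ at π (suc t))
  D L R : ℕ → ℕ
  D i = (at π i ∸ 1) + (at π i ∸ 1)
  L i = ind (2 ≤ᵇ i) * (at π i ⊓ at π (i ∸ 1))
  R i = ind (i <ᵇ n) * (at π i ⊓ at π (suc i))
  regroup : ∀ d m x → d + (m + m) + x ≡ (d + x) + 2 * m
  regroup = solve-∀
  column : ∀ i → 1 ≤ i → i ≤ n → sumTo (at π i) (λ j → deg π (i , j)) ≡ D i + (L i + R i)
  column i 1≤i i≤n = begin
    sumTo (at π i) (λ j → deg π (i , j))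
      ≡⟨ sumTo-cong (at π i) (λ j 1≤j j≤πᵢ → deg-formula π i j 1≤i i≤n 1≤j j≤πᵢ) ⟩
    sumTo (at π i) (λ j → (ind (2 ≤ᵇ j) + ind (j <ᵇ at π i))
                          + (ind (2 ≤ᵇ i) * ind (j ≤ᵇ at π (i ∸ 1)) + ind (i <ᵇ n) * ind (j ≤ᵇ at π (suc i))))
      ≡⟨ trans (sumTo-+ (at π i) _ _)
               (cong₂ _+_ (sumTo-+ (at π i) _ _)
                          (trans (sumTo-+ (at π i) _ _) (cong₂ _+_ (sumTo-* (at π i) (ind (2 ≤ᵇ i)) _) (sumTo-* (at π i) (ind (i <ᵇ n)) _)))) ⟩
    (sumTo (at π i) (λ j → ind (2 ≤ᵇ j)) + sumTo (at π i) (λ j → ind (j <ᵇ at π i)))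
      + (ind (2 ≤ᵇ i) * sumTo (at π i) (λ j → ind (j ≤ᵇ at π (i ∸ 1))) + ind (i <ᵇ n) * sumTo (at π i) (λ j → ind (j ≤ᵇ at π (suc i))))
      ≡⟨ cong₂ _+_ (cong₂ _+_ (sumTo-ind-2≤ᵇ (at π i)) (sumTo-ind-<ᵇ (at π i)))
                   (cong₂ _+_ (cong (ind (2 ≤ᵇ i) *_) (sumTo-ind-≤ᵇ (at π i) _)) (cong (ind (i <ᵇ n) *_) (sumTo-ind-≤ᵇ (at π i) _))) ⟩
    D i + (L i + R i) ∎
  vertical : sumTo n D + 2 * n ≡ 2 * sum π
  vertical = begin
    sumTo n D + 2 * n                ≡⟨ cong (sumTo n D +_) (trans (*-comm 2 n) (sym (sumTo-const n 2))) ⟩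
    sumTo n D + sumTo n (λ _ → 2)    ≡⟨ sym (sumTo-+ n _ _) ⟩
    sumTo n (λ i → D i + 2)          ≡⟨ sumTo-cong n (λ i 1≤i i≤n → double (at π i) (positive-at π π>0 i 1≤i i≤n)) ⟩
    sumTo n (λ i → 2 * at π i)       ≡⟨ sumTo-* n 2 (at π) ⟩
    2 * sumTo n (at π)               ≡⟨ cong (2 *_) (sumTo-at-id π) ⟩
    2 * sum π                        ∎
    where
    double : ∀ x → 1 ≤ x → (x ∸ 1) + (x ∸ 1) + 2 ≡ 2 * x
    double (suc x) _ = solve x
      where
      solve : ∀ x → x + x + 2 ≡ 2 * suc x
      solve = solve-∀

deg-bounds : ∀ π → All (0 <_) π → 2 ≤ length π → All (λ v → 1 ≤ deg π v × deg π v ≤ 4) (gridV π)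
deg-bounds π π>0 2≤n = All.tabulate bounds
  where
  n = length π
  bounds : ∀ {v} → v ∈ gridV π → 1 ≤ deg π v × deg π v ≤ 4
  bounds v∈ with ∈-gridV⁻ π v∈
  ... | i , j , (1≤i , i≤n) , (1≤j , j≤πᵢ) , refl rewrite deg-formula π i j 1≤i i≤n 1≤j j≤πᵢ =
    lower i j 1≤i i≤n 1≤j , upper (2 ≤ᵇ j) (j <ᵇ at π i) (2 ≤ᵇ i) (j ≤ᵇ at π (i ∸ 1)) (i <ᵇ n) (j ≤ᵇ at π (suc i))
    where
    upper : ∀ a b c d e f → (ind a + ind b) + (ind c * ind d + ind e * ind f) ≤ 4
    upper a b c d e f = +-mono-≤ (+-mono-≤ (ind≤1 a) (ind≤1 b)) (+-mono-≤ (*-mono-≤ (ind≤1 c) (ind≤1 d)) (*-mono-≤ (ind≤1 e) (ind≤1 f)))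
    own left right : ℕ → ℕ → ℕ
    own   i j = ind (2 ≤ᵇ j) + ind (j <ᵇ at π i)
    left  i j = ind (2 ≤ᵇ i) * ind (j ≤ᵇ at π (i ∸ 1))
    right i j = ind (i <ᵇ n) * ind (j ≤ᵇ at π (suc i))
    -- A vertex (i, 1) has its left neighbour, or its right one when i = 1 < n.
    lower : ∀ i j → 1 ≤ i → i ≤ n → 1 ≤ j → 1 ≤ own i j + (left i j + right i j)
    lower i             (suc (suc j)) _ _   _ = s≤s z≤n
    lower (suc (suc i)) (suc zero)    _ i≤n _ =
      ≤-trans (≤-reflexive (sym left≡1)) (≤-trans (m≤m+n _ (right (suc (suc i)) 1)) (m≤n+m _ (own (suc (suc i)) 1)))
      where
      left≡1 : left (suc (suc i)) 1 ≡ 1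
      left≡1 = trans (+-identityʳ _) (ind-≤ᵇ-≤ (positive-at π π>0 (suc i) (s≤s z≤n) (≤-trans (n≤1+n (suc i)) i≤n)))
    lower (suc zero)    (suc zero)    _ _   _ =
      ≤-trans (≤-reflexive (sym right≡1)) (≤-trans (m≤n+m _ (left 1 1)) (m≤n+m _ (own 1 1)))
      where
      right≡1 : right 1 1 ≡ 1
      right≡1 = cong₂ _*_ (ind-<ᵇ-< 2≤n) (ind-≤ᵇ-≤ (positive-at π π>0 2 (s≤s z≤n) 2≤n))

degree-classes : ∀ e → 1 ≤ e × e ≤ 4 → ind (e ≡ᵇ 1) + ind (e ≡ᵇ 2) + ind (e ≡ᵇ 3) + ind (e ≡ᵇ 4) ≡ 1
                              × ind (e ≡ᵇ 1) + 2 * ind (e ≡ᵇ 2) + 3 * ind (e ≡ᵇ 3) + 4 * ind (e ≡ᵇ 4) ≡ e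
degree-classes 1 _ = refl , refl
degree-classes 2 _ = refl , refl
degree-classes 3 _ = refl , refl
degree-classes 4 _ = refl , refl
degree-classes (suc (suc (suc (suc (suc _))))) (_ , s≤s (s≤s (s≤s (s≤s ()))))

count-by-degree : {A : Set} (d : A → ℕ) (xs : List A) → All (λ x → 1 ≤ d x × d x ≤ 4) xs →
  count (λ x → d x ≡ᵇ 1) xs + count (λ x → d x ≡ᵇ 2) xs + count (λ x → d x ≡ᵇ 3) xs + count (λ x → d x ≡ᵇ 4) xs
    ≡ length xs
  × count (λ x → d x ≡ᵇ 1) xs + 2 * count (λ x → d x ≡ᵇ 2) xs + 3 * count (λ x → d x ≡ᵇ 3) xs + 4 * count (λ x → d x ≡ᵇ 4) xs
    ≡ sum (map d xs)
count-by-degree d []       []             = refl , refl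
count-by-degree d (x ∷ xs) (dx-range ∷ r)
  with one , weighted ← degree-classes (d x) dx-range | ih₁ , ih₂ ← count-by-degree d xs r =
  trans (split (ind (d x ≡ᵇ 1)) (ind (d x ≡ᵇ 2)) (ind (d x ≡ᵇ 3)) (ind (d x ≡ᵇ 4)) _ _ _ _) (cong₂ _+_ one ih₁) ,
  trans (split-weighted (ind (d x ≡ᵇ 1)) (ind (d x ≡ᵇ 2)) (ind (d x ≡ᵇ 3)) (ind (d x ≡ᵇ 4)) _ _ _ _) (cong₂ _+_ weighted ih₂)
  where
  split : ∀ a b c e p q r s → (a + p) + (b + q) + (c + r) + (e + s) ≡ (a + b + c + e) + (p + q + r + s)
  split = solve-∀
  split-weighted : ∀ a b c e p q r s → (a + p) + 2 * (b + q) + 3 * (c + r) + 4 * (e + s)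
                                         ≡ (a + 2 * b + 3 * c + 4 * e) + (p + 2 * q + 3 * r + 4 * s)
  split-weighted = solve-∀

positive-∈-Av213 : ∀ n {π} → π ∈ Av213 n → All (0 <_) π
positive-∈-Av213 n π∈ = All.map proj₁ (proj₁ (proj₂ (proj₁ (∈-Av213⁻ n π∈))))

2*V≡ : ∀ n → 2 * V n ≡ length (Av213 n) * (n * (n + 1))
2*V≡ n = begin
  2 * V n                                     ≡⟨ sym (sumMap-* (Av213 n) 2 _) ⟩
  sumMap (Av213 n) (λ π → 2 * length (gridV π)) ≡⟨ sumMap-cong (Av213 n) 2*vertices ⟩
  sumMap (Av213 n) (λ _ → n * (n + 1))        ≡⟨ sumMap-const (Av213 n) _ ⟩
  length (Av213 n) * (n * (n + 1))            ∎
  where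
  2*vertices : ∀ π → π ∈ Av213 n → 2 * length (gridV π) ≡ n * (n + 1)
  2*vertices π π∈ = trans (cong (2 *_) (length-gridV π))
                      (trans (2*sum-permutation (proj₁ (∈-Av213⁻ n π∈))) (cong (n *_) (+-comm 1 n)))

2*V≡binomial : ∀ n → 2 * V n ≡ n * centralBinomial n
2*V≡binomial n = begin
  2 * V n                           ≡⟨ 2*V≡ n ⟩
  length (Av213 n) * (n * (n + 1))  ≡⟨ cong (_* (n * (n + 1))) (length-Av213 n) ⟩
  catalan n * (n * (n + 1))         ≡⟨ reorder (catalan n) n ⟩
  n * (suc n * catalan n)           ≡⟨ cong (n *_) (suc-*-catalan n) ⟩
  n * centralBinomial n             ∎
  where
  reorder : ∀ c n → c * (n * (n + 1)) ≡ n * (suc n * c)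
  reorder = solve-∀

Sig≡ : ∀ n → Sig n ≡ length (Av213 n) * (n * (n ∸ 1)) + 2 * H n
Sig≡ n = +-cancelʳ-≡ (length (Av213 n) * (2 * n)) _ _ (begin
  Sig n + length (Av213 n) * (2 * n)
    ≡⟨ cong (Sig n +_) (sym (sumMap-const (Av213 n) (2 * n))) ⟩
  Sig n + sumMap (Av213 n) (λ _ → 2 * n)
    ≡⟨ sym (sumMap-+ (Av213 n) _ _) ⟩
  sumMap (Av213 n) (λ π → sum (map (deg π) (gridV π)) + 2 * n)
    ≡⟨ sumMap-cong (Av213 n) per-permutation ⟩
  sumMap (Av213 n) (λ π → 2 * sum π + 2 * minAdj π)
    ≡⟨ sumMap-+ (Av213 n) _ _ ⟩
  sumMap (Av213 n) (λ π → 2 * sum π) + sumMap (Av213 n) (λ π → 2 * minAdj π)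
    ≡⟨ cong₂ _+_ (trans (sumMap-cong (Av213 n) (λ π _ → sym (cong (2 *_) (length-gridV π))))
                        (trans (sumMap-* (Av213 n) 2 _) (2*V≡ n)))
                 (sumMap-* (Av213 n) 2 minAdj) ⟩
  length (Av213 n) * (n * (n + 1)) + 2 * H n
    ≡⟨ regroup (length (Av213 n)) n (2 * H n) ⟩
  length (Av213 n) * (n * (n ∸ 1)) + 2 * H n + length (Av213 n) * (2 * n) ∎)
  where
  per-permutation : ∀ π → π ∈ Av213 n → sum (map (deg π) (gridV π)) + 2 * n ≡ 2 * sum π + 2 * minAdj π
  per-permutation π π∈ = trans (cong (λ t → sum (map (deg π) (gridV π)) + 2 * t) (sym (length-∈-Av213 n π∈)))
                               (degreeSum π (positive-∈-Av213 n π∈))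
  regroup : ∀ c n h → c * (n * (n + 1)) + h ≡ c * (n * (n ∸ 1)) + h + c * (2 * n)
  regroup c zero    h = solve c h
    where
    solve : ∀ c h → c * 0 + h ≡ c * 0 + h + c * 0
    solve = solve-∀
  regroup c (suc m) h = solve c m h
    where
    solve : ∀ c m h → c * (suc m * (suc m + 1)) + h ≡ c * (suc m * m) + h + c * (2 * suc m)
    solve = solve-∀

2*H≡ : ∀ n → 2 * H n + 2 * deficit n ≡ catalan n * (n * suc n)
2*H≡ n = trans (cong (λ h → 2 * h + 2 * deficit n) (sumMap-cong (Av213 n) (λ π _ → minAdj≡adjacentMins π)))
               (adjacentMins-Av213 n)

Sig≡binomial : ∀ m → (suc m + 1) * (Sig (suc m) + 2 * 4 ^ m) ≡ 2 * (suc m * suc m) * centralBinomial (suc m)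
Sig≡binomial m = begin
  (n + 1) * (Sig n + 2 * 4 ^ m)
    ≡⟨ cong (λ s → (n + 1) * (s + 2 * 4 ^ m)) (Sig≡ n) ⟩
  (n + 1) * (length (Av213 n) * (n * m) + 2 * H n + 2 * 4 ^ m)
    ≡⟨ cong (λ t → (n + 1) * t) (+-assoc (length (Av213 n) * (n * m)) (2 * H n) (2 * 4 ^ m)) ⟩
  (n + 1) * (length (Av213 n) * (n * m) + (2 * H n + 2 * 4 ^ m))
    ≡⟨ cong₂ (λ c h → (n + 1) * (c * (n * m) + h)) (length-Av213 n) (2*H≡ n) ⟩
  (n + 1) * (catalan n * (n * m) + catalan n * (n * suc n))
    ≡⟨ reorder (catalan n) m ⟩
  2 * (n * n) * (suc n * catalan n)
    ≡⟨ cong (2 * (n * n) *_) (suc-*-catalan n) ⟩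
  2 * (n * n) * centralBinomial n ∎
  where
  n = suc m
  reorder : ∀ c m → (suc m + 1) * (c * (suc m * m) + c * (suc m * suc (suc m))) ≡ 2 * (suc m * suc m) * (suc (suc m) * c)
  reorder = solve-∀

degreeCount : ℕ → List ℕ → ℕ
degreeCount r π = count (λ v → deg π v ≡ᵇ r) (gridV π)

deg-bounds-∈-Av213 : ∀ n → 2 ≤ n → ∀ {π} → π ∈ Av213 n → All (λ v → 1 ≤ deg π v × deg π v ≤ 4) (gridV π)
deg-bounds-∈-Av213 n 2≤n {π} π∈ = deg-bounds π (positive-∈-Av213 n π∈) (≤-trans 2≤n (≤-reflexive (sym (length-∈-Av213 n π∈))))

Q-sum : ∀ n → 2 ≤ n → Q 1 n + Q 2 n + Q 3 n + Q 4 n ≡ V n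
Q-sum n 2≤n = begin
  Q 1 n + Q 2 n + Q 3 n + Q 4 n
    ≡⟨ sym (sumMap-+₄ (Av213 n) (degreeCount 1) (degreeCount 2) (degreeCount 3) (degreeCount 4)) ⟩
  sumMap (Av213 n) (λ π → degreeCount 1 π + degreeCount 2 π + degreeCount 3 π + degreeCount 4 π)
    ≡⟨ sumMap-cong (Av213 n) (λ π π∈ → proj₁ (count-by-degree (deg π) (gridV π) (deg-bounds-∈-Av213 n 2≤n π∈))) ⟩
  V n ∎

Q-weighted-sum : ∀ n → 2 ≤ n → Q 1 n + 2 * Q 2 n + 3 * Q 3 n + 4 * Q 4 n ≡ Sig n
Q-weighted-sum n 2≤n = begin
  Q 1 n + 2 * Q 2 n + 3 * Q 3 n + 4 * Q 4 n
    ≡⟨ cong₂ _+_ (cong₂ (λ s t → Q 1 n + s + t) (sym (sumMap-* (Av213 n) 2 _)) (sym (sumMap-* (Av213 n) 3 _)))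
                 (sym (sumMap-* (Av213 n) 4 _)) ⟩
  sumMap (Av213 n) (degreeCount 1) + sumMap (Av213 n) (λ π → 2 * degreeCount 2 π)
    + sumMap (Av213 n) (λ π → 3 * degreeCount 3 π) + sumMap (Av213 n) (λ π → 4 * degreeCount 4 π)
    ≡⟨ sym (sumMap-+₄ (Av213 n) _ _ _ _) ⟩
  sumMap (Av213 n) (λ π → degreeCount 1 π + 2 * degreeCount 2 π + 3 * degreeCount 3 π + 4 * degreeCount 4 π)
    ≡⟨ sumMap-cong (Av213 n) (λ π π∈ → proj₂ (count-by-degree (deg π) (gridV π) (deg-bounds-∈-Av213 n 2≤n π∈))) ⟩
  Sig n ∎

proposition5p1 : (n : ℕ) → n ≥ 1 →
    (2 * V n ≡ length (Av213 n) * (n * (n + 1)) × 2 * V n ≡ n * ((2 * n) C n))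
    × (Sig n ≡ length (Av213 n) * (n * (n ∸ 1)) + 2 * H n
       × (n + 1) * (Sig n + 2 * 4 ^ (n ∸ 1)) ≡ 2 * (n * n) * ((2 * n) C n))
    × (n ≥ 2 → Q 1 n + Q 2 n + Q 3 n + Q 4 n ≡ V n
              × Q 1 n + 2 * Q 2 n + 3 * Q 3 n + 4 * Q 4 n ≡ Sig n)
proposition5p1 n@(suc m) _ =
  (2*V≡ n , 2*V≡binomial n) ,
  (Sig≡ n , Sig≡binomial m) ,
  λ 2≤n → Q-sum n 2≤n , Q-weighted-sum n 2≤n
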